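{- Let $n$ and $k$ be integers with $1 \leq k \leq n-3$, and let $G$ be a simple connected graph on $n$ vertices having exactly $k$ cut edges. Then $$\Pi_1(G) \geq 4^{n-k-1}(k+2)^2,$$ with equality if and only if $G \cong C_n^S$.
   Context: For a graph $G$ with vertex degrees $d(u)$, the first multiplicative Zagreb index is $\Pi_1(G)=\prod_{u\in V(G)} d(u)^2$. A cut edge of a connected graph is an edge whose deletion disconnects the graph. $C_n^S$ denotes the $n$-vertex graph obtained from a cycle $C_{n-k}$ by attaching $k$ pendent vertices (new vertices of degree $1$) all adjacent to one common vertex of the cycle (equivalently, identifying the center of a star with $k$ edges with a vertex of $C_{n-k}$). -}

module Defs where

open import Data.Nat using (ℕ; zero; suc; _+_; _*_; _∸_; _^_; _<ᵇ_; _≡ᵇ_)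
open import Data.Bool using (Bool; true; false; if_then_else_; _∧_; _∨_; not)
open import Data.Fin using (Fin; toℕ; _<_)
open import Data.Fin.Properties using (_≟_)
open import Data.List using (List; map; allFin; length)
open import Data.Nat.ListAction using (sum; product)
open import Data.List.Membership.Propositional using (_∈_)
open import Data.List.Relation.Unary.Unique.Propositional using (Unique)
open import Data.Product using (Σ; _×_; _,_)
open import Relation.Binary.PropositionalEquality using (_≡_)
open import Relation.Nullary using (¬_)
open import Relation.Nullary.Decidable using (⌊_⌋)
open import Function.Bundles using (_↔_; Inverse; _⇔_)

Adj : ℕ → Set
Adj n = Fin n → Fin n → Bool

record Graph (n : ℕ) : Set where
  field
    adj    : Adj n
    sym    : ∀ u v → adj u v ≡ adj v u
    irrefl : ∀ u → adj u u ≡ false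
open Graph public

degree : ∀ {n} → Adj n → Fin n → ℕ
degree {n} A u = sum (map (λ v → if A u v then 1 else 0) (allFin n))

Π₁ : ∀ {n} → Graph n → ℕ
Π₁ {n} G = product (map (λ u → degree (adj G) u ^ 2) (allFin n))

data Reach {n : ℕ} (A : Adj n) : Fin n → Fin n → Set where
  here : ∀ {u} → Reach A u u
  step : ∀ {u v w} → A u v ≡ true → Reach A v w → Reach A u w

Connected : ∀ {n} → Adj n → Set
Connected A = ∀ u v → Reach A u v

removeEdge : ∀ {n} → Adj n → Fin n → Fin n → Adj n
removeEdge A u v x y =
  if (⌊ x ≟ u ⌋ ∧ ⌊ y ≟ v ⌋) ∨ (⌊ x ≟ v ⌋ ∧ ⌊ y ≟ u ⌋) then false else A x y

IsCutEdge : ∀ {n} → Adj n → Fin n → Fin n → Set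
IsCutEdge A u v = (A u v ≡ true) × ¬ Connected (removeEdge A u v)

-- G has exactly k cut edges: the cut edges, each listed once as a pair (u,v)
-- with u < v, form a duplicate-free list of length k.
HasExactlyCutEdges : ∀ {n} → Adj n → ℕ → Set
HasExactlyCutEdges {n} A k =
  Σ (List (Fin n × Fin n)) λ L →
    Unique L × length L ≡ k ×
    (∀ u v → (u , v) ∈ L → u < v) ×
    (∀ u v → u < v → ((u , v) ∈ L ⇔ IsCutEdge A u v))

_≅_ : ∀ {n} → Adj n → Adj n → Set
_≅_ {n} A B = Σ (Fin n ↔ Fin n) λ σ →
  ∀ u v → A u v ≡ B (Inverse.to σ u) (Inverse.to σ v)

-- C_n^S (for k ≤ n - 3): vertices 0,…,m-1 (m = n - k) form the cycle C_m
-- (i ~ i+1, and 0 ~ m-1); vertices m,…,n-1 are pendent vertices adjacent to 0.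
csAdjℕ : ℕ → ℕ → ℕ → ℕ → Bool
csAdjℕ n k a b =
  let m = n ∸ k in
  if (a <ᵇ m) ∧ (b <ᵇ m)
  then (b ≡ᵇ suc a) ∨ (a ≡ᵇ suc b)
       ∨ ((a ≡ᵇ 0) ∧ (b ≡ᵇ m ∸ 1)) ∨ ((b ≡ᵇ 0) ∧ (a ≡ᵇ m ∸ 1))
  else ((a ≡ᵇ 0) ∧ not (b <ᵇ m)) ∨ ((b ≡ᵇ 0) ∧ not (a <ᵇ m))

C^S : (n k : ℕ) → Adj n
C^S n k u v = csAdjℕ n k (toℕ u) (toℕ v)

module Submission where

-- As Π₁(G) = (∏ d(u))², we bound ∏ d(u) ≥ 2^(n-k-1) (k+2).  Let p be the number
-- of pendent vertices, q = n - p, and e = Σ (d(u) ∸ 2) the excess.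
--   (1) Pendent edges are distinct cut edges, so p ≤ k.
--   (2) As k ≤ n - 3 some spanning-tree edge is not a cut edge; a spanning tree
--       of G without it, plus that edge, shows Σ d(u) ≥ 2n, i.e. p ≤ e.
--   (3) 2^(n-k) (2+k) ≤ 2^q (2+p) ≤ 2^q (2+e) ≤ 2 ∏ d(u), the first step strict
--       if p < k and the last strict if two degrees are ≥ 3.
-- At equality p = e = k and a single vertex c has degree ≥ 3, namely k + 2; then
-- all pendents hang at c, the other vertices have degree 2, and the walk from c
-- through non-pendent vertices closes after all n - k of them: an isomorphism
-- onto Cₙˢ.  Conversely ∏ d(u) is invariant under isomorphism and Cₙˢ attains it.

open import Defs hiding (sym)
open import Data.Nat using (ℕ; zero; suc; _+_; _*_; _∸_; _^_; _≤_; _<_; z≤n; s≤s; _≤?_; _<?_; _<ᵇ_; _≡ᵇ_)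
import Data.Nat as ℕ
open import Data.Nat.Properties
open import Data.Nat.Tactic.RingSolver using (solve-∀)
open import Data.Nat.ListAction using (sum; product)
open import Data.Nat.ListAction.Properties using (sum-↭; product-↭; product-++)
open import Data.Bool using (Bool; true; false; if_then_else_; _∧_; _∨_; not; T)
import Data.Bool.Properties as Bool
open import Data.Fin using (Fin; toℕ; fromℕ<)
import Data.Fin as Fin
import Data.Fin.Properties as FinP
open import Data.Maybe using (fromMaybe)
open import Data.List using (List; []; _∷_; head; tabulate; _++_; length; map; filter; allFin; upTo; applyUpTo)
open import Data.List.Properties
  using (length-++; length-map; length-tabulate; length-applyUpTo; map-tabulate; map-upTo; map-∘; map-cong; applyUpTo-∷ʳ)
open import Data.List.Membership.Propositional using (_∈_; _∉_)
open import Data.List.Membership.Propositional.Properties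
  using (∈-∃++; ∈-allFin; ∈-map⁺; ∈-map⁻; ∈-++⁺ˡ; ∈-++⁺ʳ; ∈-++⁻; ∈-filter⁺; ∈-filter⁻
        ; ∈-upTo⁺; ∈-upTo⁻; ∈-applyUpTo⁺; ∈-applyUpTo⁻)
open import Data.List.Membership.Propositional.Properties.WithK using (unique∧set⇒bag)
import Data.List.Membership.DecPropositional as DecMembership
open import Data.List.Relation.Binary.Subset.Propositional using (_⊆_)
open import Data.List.Relation.Binary.BagAndSetEquality using (∼bag⇒↭)
open import Data.List.Relation.Binary.Permutation.Propositional using (_↭_)
import Data.List.Relation.Binary.Permutation.Propositional.Properties as Perm
open import Data.List.Relation.Unary.Any using (here; there; satisfied)
open import Data.List.Relation.Unary.All using (All; []; _∷_; all?)
import Data.List.Relation.Unary.All as All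
open import Data.List.Relation.Unary.All.Properties using (¬Any⇒All¬; All¬⇒¬Any; ¬All⇒Any¬; map⁺)
open import Data.List.Relation.Unary.AllPairs using ([]; _∷_)
open import Data.List.Relation.Unary.Unique.Propositional using (Unique)
import Data.List.Relation.Unary.Unique.Propositional.Properties as Unique
open import Data.Product using (Σ; ∃; _×_; _,_; proj₁; proj₂; swap)
import Data.Product.Properties as Product
open import Data.Sum using (_⊎_; inj₁; inj₂)
open import Data.Empty using (⊥; ⊥-elim)
open import Data.Unit using (tt)
open import Function.Bundles using (_↔_; _⇔_; mk⇔; mk↔ₛ′; Inverse; Equivalence)
open import Relation.Nullary using (¬_; Dec; yes; no; ¬?)
open import Relation.Nullary.Decidable using (⌊_⌋)
open import Relation.Unary using (Decidable)
open import Relation.Binary using (tri<; tri≈; tri>)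
open import Relation.Binary.Definitions using (DecidableEquality)
open import Relation.Binary.PropositionalEquality

module _ {a} {A : Set a} where

  ∈-delete : ∀ {x z : A} as bs → z ∈ as ++ x ∷ bs → z ≢ x → z ∈ as ++ bs
  ∈-delete []       bs (here z≡x) z≢x = ⊥-elim (z≢x z≡x)
  ∈-delete []       bs (there z∈) _   = z∈
  ∈-delete (_ ∷ as) bs (here z≡a) _   = here z≡a
  ∈-delete (_ ∷ as) bs (there z∈) z≢x = there (∈-delete as bs z∈ z≢x)

  length-delete : ∀ (x : A) as bs → length (as ++ x ∷ bs) ≡ suc (length (as ++ bs))
  length-delete x []       bs = refl
  length-delete x (_ ∷ as) bs = cong suc (length-delete x as bs)

  unique-cons : ∀ {x : A} {xs} → Unique xs → x ∉ xs → Unique (x ∷ xs)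
  unique-cons u x∉ = ¬Any⇒All¬ _ x∉ ∷ u

  unique-length-≤ : ∀ {xs ys : List A} → Unique xs → xs ⊆ ys → length xs ≤ length ys
  unique-length-≤ {[]}     _        _   = z≤n
  unique-length-≤ {x ∷ xs} (x∉ ∷ u) xs⊆ with ∈-∃++ (xs⊆ (here refl))
  ... | as , bs , refl = subst (suc (length xs) ≤_) (sym (length-delete x as bs))
          (s≤s (unique-length-≤ u λ z∈ → ∈-delete as bs (xs⊆ (there z∈))
                  λ { refl → All¬⇒¬Any x∉ z∈ }))

  unique-same-members-↭ : ∀ {xs ys : List A} → Unique xs → Unique ys →
    xs ⊆ ys → ys ⊆ xs → xs ↭ ys
  unique-same-members-↭ uxs uys xs⊆ ys⊆ = ∼bag⇒↭ (unique∧set⇒bag uxs uys (mk⇔ xs⊆ ys⊆))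

  unique-same-members-length : ∀ {xs ys : List A} → Unique xs → Unique ys →
    xs ⊆ ys → ys ⊆ xs → length xs ≡ length ys
  unique-same-members-length uxs uys xs⊆ ys⊆ =
    ≤-antisym (unique-length-≤ uxs xs⊆) (unique-length-≤ uys ys⊆)

  sole-member : ∀ (xs : List A) d → length xs ≡ 1 →
    fromMaybe d (head xs) ∈ xs × (∀ {y} → y ∈ xs → y ≡ fromMaybe d (head xs))
  sole-member (x ∷ []) _ _ = here refl , λ { (here y≡x) → y≡x }

  head-∈ : ∀ (xs : List A) d → 1 ≤ length xs → fromMaybe d (head xs) ∈ xs
  head-∈ (x ∷ _) _ _ = here refl

  module _ (_≟_ : DecidableEquality A) where
    open DecMembership _≟_ using (_∈?_)

    otherThan : A → List A → A → A
    otherThan d (y₁ ∷ y₂ ∷ _) v with y₁ ≟ v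
    ... | yes _ = y₂
    ... | no  _ = y₁
    otherThan d _ _ = d

    otherThan-spec : ∀ d (xs : List A) {v} → length xs ≡ 2 → Unique xs → v ∈ xs →
      let x = otherThan d xs v in x ∈ xs × x ≢ v × (∀ {y} → y ∈ xs → y ≡ v ⊎ y ≡ x)
    otherThan-spec d (y₁ ∷ y₂ ∷ []) {v} _ ((y₁≢y₂ ∷ []) ∷ _) v∈ with y₁ ≟ v
    ... | yes refl = there (here refl) , (λ y₂≡y₁ → y₁≢y₂ (sym y₂≡y₁)) ,
                     λ { (here y≡y₁) → inj₁ y≡y₁ ; (there (here y≡y₂)) → inj₂ y≡y₂ }
    ... | no y₁≢v with v∈
    ...   | here v≡y₁         = ⊥-elim (y₁≢v (sym v≡y₁))
    ...   | there (here refl) = here refl , y₁≢v ,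
                                λ { (here y≡y₁) → inj₂ y≡y₁ ; (there (here y≡y₂)) → inj₁ y≡y₂ }

    unique-⊆-long⇒⊇ : ∀ {xs ys : List A} → Unique xs → xs ⊆ ys →
      length ys ≤ length xs → ys ⊆ xs
    unique-⊆-long⇒⊇ {xs} u xs⊆ long {y} y∈ with y ∈? xs
    ... | yes y∈xs = y∈xs
    ... | no  y∉xs = ⊥-elim (<-irrefl refl (<-≤-trans
          (unique-length-≤ (unique-cons u y∉xs) λ { (here refl) → y∈ ; (there z∈) → xs⊆ z∈ })
          long))


  length-filter-split : ∀ {ℓ} {P : A → Set ℓ} (P? : Decidable P) xs →
    length (filter P? xs) + length (filter (λ x → ¬? (P? x)) xs) ≡ length xs
  length-filter-split P? []       = refl
  length-filter-split P? (x ∷ xs) with P? x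
  ... | yes _ = cong suc (length-filter-split P? xs)
  ... | no  _ = trans (+-suc _ _) (cong suc (length-filter-split P? xs))

  count-true : ∀ (b : A → Bool) xs →
    sum (map (λ x → if b x then 1 else 0) xs) ≡ length (filter (λ x → b x Bool.≟ true) xs)
  count-true b []       = refl
  count-true b (x ∷ xs) with b x
  ... | true  = cong suc (count-true b xs)
  ... | false = count-true b xs

module _ {a b} {A : Set a} {B : Set b} (f : A → B) where

  unique-map : ∀ {xs : List A} → Unique xs →
    (∀ {x y} → x ∈ xs → y ∈ xs → f x ≡ f y → x ≡ y) → Unique (map f xs)
  unique-map {[]}     _        _   = []
  unique-map {x ∷ xs} (x∉ ∷ u) inj =
    ¬Any⇒All¬ _ fx∉ ∷ unique-map u (λ x∈ y∈ → inj (there x∈) (there y∈))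
    where
    fx∉ : f x ∉ map f xs
    fx∉ fx∈ with ∈-map⁻ f fx∈
    ... | y , y∈ , fx≡fy = All¬⇒¬Any x∉ (subst (_∈ xs) (sym (inj (here refl) (there y∈) fx≡fy)) y∈)

missing-vertex : ∀ {n} (S : List (Fin n)) → length S < n → ∃ λ w → w ∉ S
missing-vertex {n} S short = from-test (all? (_∈? S) (allFin n))
  where
  open DecMembership (FinP._≟_ {n}) using (_∈?_)
  from-test : Dec (All (_∈ S) (allFin n)) → ∃ λ w → w ∉ S
  from-test (no ¬all)  = satisfied (¬All⇒Any¬ (_∈? S) (allFin n) ¬all)
  from-test (yes all∈) = ⊥-elim (<-irrefl refl (<-≤-trans short
    (subst (_≤ length S) (length-tabulate {n = n} (λ i → i))
      (unique-length-≤ (Unique.allFin⁺ n) (All.lookup all∈)))))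

module _ {n : ℕ} where

  open DecMembership (FinP._≟_ {n}) using (_∈?_)

  neighbours : Adj n → Fin n → List (Fin n)
  neighbours A u = filter (λ v → A u v Bool.≟ true) (allFin n)

  degree≡length-neighbours : ∀ A u → degree A u ≡ length (neighbours A u)
  degree≡length-neighbours A u = count-true (A u) (allFin n)

  neighbours-unique : ∀ A u → Unique (neighbours A u)
  neighbours-unique A u = Unique.filter⁺ _ (Unique.allFin⁺ n)

  neighbours⁺ : ∀ {A u v} → A u v ≡ true → v ∈ neighbours A u
  neighbours⁺ {A} {u} {v} uv = ∈-filter⁺ (λ v → A u v Bool.≟ true) (∈-allFin v) uv

  neighbours⁻ : ∀ {A u v} → v ∈ neighbours A u → A u v ≡ true
  neighbours⁻ {A} {u} v∈ = proj₂ (∈-filter⁻ (λ v → A u v Bool.≟ true) {xs = allFin n} v∈)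

  degreeSum : Adj n → ℕ
  degreeSum A = sum (map (degree A) (allFin n))

  adjacentPairs : Adj n → List (Fin n) → List (Fin n × Fin n)
  adjacentPairs A []       = []
  adjacentPairs A (u ∷ us) = map (u ,_) (neighbours A u) ++ adjacentPairs A us

  length-adjacentPairs : ∀ A us → length (adjacentPairs A us) ≡ sum (map (degree A) us)
  length-adjacentPairs A []       = refl
  length-adjacentPairs A (u ∷ us) = trans (length-++ (map (u ,_) (neighbours A u)))
    (cong₂ _+_ (trans (length-map _ (neighbours A u)) (sym (degree≡length-neighbours A u)))
               (length-adjacentPairs A us))

  ∈-adjacentPairs : ∀ A {x y} us → x ∈ us → A x y ≡ true → (x , y) ∈ adjacentPairs A us
  ∈-adjacentPairs A (u ∷ us) (here refl) xy = ∈-++⁺ˡ (∈-map⁺ (u ,_) (neighbours⁺ {A} xy))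
  ∈-adjacentPairs A (u ∷ us) (there x∈) xy = ∈-++⁺ʳ _ (∈-adjacentPairs A us x∈ xy)

  adjacent-pairs-≤-degreeSum : ∀ A (Ps : List (Fin n × Fin n)) → Unique Ps →
    (∀ {x y} → (x , y) ∈ Ps → A x y ≡ true) → length Ps ≤ degreeSum A
  adjacent-pairs-≤-degreeSum A Ps u adj = subst (length Ps ≤_) (length-adjacentPairs A (allFin n))
    (unique-length-≤ u λ { {x , y} xy∈ → ∈-adjacentPairs A (allFin n) (∈-allFin x) (adj xy∈) })

  closed-reach : ∀ {A} (S : List (Fin n)) → (∀ {x y} → x ∈ S → A x y ≡ true → y ∈ S) →
    ∀ {x z} → Reach A x z → x ∈ S → z ∈ S
  closed-reach S closed here        x∈ = x∈
  closed-reach S closed (step xy r) x∈ = closed-reach S closed r (closed x∈ xy)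

  exit-edge : ∀ {A} (S : List (Fin n)) → ∀ {x z} → Reach A x z → x ∈ S → z ∉ S →
    Σ (Fin n) λ a → Σ (Fin n) λ b → a ∈ S × b ∉ S × A a b ≡ true
  exit-edge S here x∈ z∉ = ⊥-elim (z∉ x∈)
  exit-edge S {x} (step {v = v} xv r) x∈ z∉ with v ∈? S
  ... | yes v∈ = exit-edge S r v∈ z∉
  ... | no  v∉ = x , v , x∈ , v∉ , xv

  reach-cong : ∀ {A B : Adj n} → (∀ a b → A a b ≡ B a b) → ∀ {x y} → Reach A x y → Reach B x y
  reach-cong A≗B here        = here
  reach-cong A≗B (step xy r) = step (trans (sym (A≗B _ _)) xy) (reach-cong A≗B r)

  module _ (A : Adj n) (u v : Fin n) where

    private
      removed? : Fin n → Fin n → Bool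
      removed? x y = (⌊ x FinP.≟ u ⌋ ∧ ⌊ y FinP.≟ v ⌋) ∨ (⌊ x FinP.≟ v ⌋ ∧ ⌊ y FinP.≟ u ⌋)

    removeEdge-⊆ : ∀ x y → removeEdge A u v x y ≡ true → A x y ≡ true
    removeEdge-⊆ x y xy with removed? x y
    ... | false = xy

    removeEdge-removes : removeEdge A u v u v ≡ false
    removeEdge-removes with u FinP.≟ u | v FinP.≟ v
    ... | yes _ | yes _ = refl
    ... | no u≢u | _     = ⊥-elim (u≢u refl)
    ... | yes _ | no v≢v = ⊥-elim (v≢v refl)

    removeEdge-swap : ∀ x y → removeEdge A u v x y ≡ removeEdge A v u x y
    removeEdge-swap x y = cong (λ c → if c then false else A x y)
      (Bool.∨-comm (⌊ x FinP.≟ u ⌋ ∧ ⌊ y FinP.≟ v ⌋) _)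

    removeEdge-symmetric : (∀ x y → A x y ≡ A y x) →
      ∀ x y → removeEdge A u v x y ≡ removeEdge A u v y x
    removeEdge-symmetric A-sym x y rewrite A-sym x y
      | Bool.∧-comm ⌊ y FinP.≟ u ⌋ ⌊ x FinP.≟ v ⌋ | Bool.∧-comm ⌊ y FinP.≟ v ⌋ ⌊ x FinP.≟ u ⌋
      | Bool.∨-comm (⌊ x FinP.≟ v ⌋ ∧ ⌊ y FinP.≟ u ⌋) (⌊ x FinP.≟ u ⌋ ∧ ⌊ y FinP.≟ v ⌋) = refl

  removeEdge-removes′ : ∀ A u v → removeEdge A u v v u ≡ false
  removeEdge-removes′ A u v = trans (removeEdge-swap A u v v u) (removeEdge-removes A v u)

-- Spanning trees, and the degree-sum bound (2).

_≟pair_ : ∀ {n} → DecidableEquality (Fin n × Fin n)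
_≟pair_ = Product.≡-dec FinP._≟_ FinP._≟_

module SpanningTree {n : ℕ} (B : Adj n) (B-sym : ∀ x y → B x y ≡ B y x)
                    (conn : Connected B) (r : Fin n) where

  -- A tree grown from r with t edges: t + 1 vertices S and its 2t edges in both
  -- directions, Ps.
  record Tree (t : ℕ) : Set where
    field
      S         : List (Fin n)
      Ps        : List (Fin n × Fin n)
      S-unique  : Unique S
      S-length  : length S ≡ suc t
      r∈S       : r ∈ S
      Ps-unique : Unique Ps
      Ps-length : length Ps ≡ 2 * t
      Ps-edges  : ∀ {x y} → (x , y) ∈ Ps → B x y ≡ true × x ∈ S × y ∈ S

  -- While the tree misses a vertex, connectivity yields an edge leaving it.
  grow : ∀ t → t < n → Tree t
  grow zero    _   = record
    { S = r ∷ [] ; Ps = [] ; S-unique = [] ∷ [] ; S-length = refl ; r∈S = here refl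
    ; Ps-unique = [] ; Ps-length = refl ; Ps-edges = λ () }
  grow (suc t) t<n with grow t (<-trans (n<1+n t) t<n)
  ... | T with missing-vertex (Tree.S T) (subst (_< n) (sym (Tree.S-length T)) t<n)
  ...   | w , w∉ with exit-edge (Tree.S T) (conn r w) (Tree.r∈S T) w∉
  ...     | a , b , a∈ , b∉ , ab = record
    { S = b ∷ S ; Ps = (a , b) ∷ (b , a) ∷ Ps ; S-unique = unique-cons S-unique b∉
    ; S-length = cong suc S-length ; r∈S = there r∈S
    ; Ps-unique = unique-cons (unique-cons Ps-unique ba∉) ab∉
    ; Ps-length = trans (cong (λ l → suc (suc l)) Ps-length) (cong suc (sym (+-suc t (t + 0))))
    ; Ps-edges = edges }
    where
    open Tree T
    ba∉ : (b , a) ∉ Ps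
    ba∉ ba∈ = b∉ (proj₁ (proj₂ (Ps-edges ba∈)))
    ab∉ : (a , b) ∉ (b , a) ∷ Ps
    ab∉ (here ab≡ba) = b∉ (subst (_∈ S) (cong proj₁ ab≡ba) a∈)
    ab∉ (there ab∈)  = b∉ (proj₂ (proj₂ (Ps-edges ab∈)))
    edges : ∀ {x y} → (x , y) ∈ (a , b) ∷ (b , a) ∷ Ps → B x y ≡ true × x ∈ b ∷ S × y ∈ b ∷ S
    edges (here refl)         = ab , there a∈ , here refl
    edges (there (here refl)) = trans (B-sym b a) ab , here refl , there a∈
    edges (there (there xy∈)) with Ps-edges xy∈
    ... | xy , x∈ , y∈ = xy , there x∈ , there y∈

  spanning-pairs : Σ (List (Fin n × Fin n)) λ Ps → Unique Ps ×
    (∀ {x y} → (x , y) ∈ Ps → B x y ≡ true) × length Ps ≡ 2 * (n ∸ 1)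
  spanning-pairs with grow (n ∸ 1) (pred<n r)
    where
    pred<n : ∀ {m} → Fin m → m ∸ 1 < m
    pred<n {suc m} _ = n<1+n m
  ... | T = Tree.Ps T , Tree.Ps-unique T , (λ xy∈ → proj₁ (Tree.Ps-edges T xy∈)) , Tree.Ps-length T

true≢false : true ≢ false
true≢false ()

k+3≤n⇒2k<2[n-1] : ∀ {k n} → k + 3 ≤ n → k + k < 2 * (n ∸ 1)
k+3≤n⇒2k<2[n-1] {k} {n} k+3≤n = begin-strict
  k + k        <⟨ subst (k + k <_) (sym (double k)) (m≤m+n (suc (k + k)) 3) ⟩
  2 * (k + 2)  ≤⟨ *-monoʳ-≤ 2 (subst (_≤ n ∸ 1) (+-∸-assoc k {3} {1} (s≤s z≤n)) (∸-monoˡ-≤ 1 k+3≤n)) ⟩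
  2 * (n ∸ 1)  ∎
  where
  open ≤-Reasoning
  double : ∀ k → 2 * (k + 2) ≡ suc (k + k) + 3
  double = solve-∀

module _ {n : ℕ} (G : Graph n) where

  private
    A : Adj n
    A = adj G

  adjacent⇒≢ : ∀ {x y} → A x y ≡ true → x ≢ y
  adjacent⇒≢ {x} xy refl = true≢false (trans (sym xy) (Graph.irrefl G x))

  cut-edge-sym : ∀ {x y} → IsCutEdge A x y → IsCutEdge A y x
  cut-edge-sym {x} {y} (xy , disconnected) =
    trans (Graph.sym G y x) xy ,
    λ conn → disconnected λ a b → reach-cong (λ p q → removeEdge-swap A y x p q) (conn a b)

  -- If G − uv is connected, a spanning tree of G − uv plus the edge uv in both
  -- directions gives 2n distinct adjacent ordered pairs of G.
  non-cut-edge⇒2n≤degreeSum : ∀ u v → A u v ≡ true → Connected (removeEdge A u v) →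
    2 * n ≤ degreeSum A
  non-cut-edge⇒2n≤degreeSum u v uv conn
    with SpanningTree.spanning-pairs (removeEdge A u v)
           (removeEdge-symmetric A u v (Graph.sym G)) conn u
  ... | Ps , Ps-unique , Ps-edges , Ps-length =
    subst (_≤ degreeSum A) (two-more n u)
      (subst (λ l → suc (suc l) ≤ degreeSum A) Ps-length
        (adjacent-pairs-≤-degreeSum A _ (unique-cons (unique-cons Ps-unique vu∉) uv∉) edges))
    where
    two-more : ∀ m → Fin m → suc (suc (2 * (m ∸ 1))) ≡ 2 * m
    two-more (suc m) _ = cong suc (sym (+-suc m (m + 0)))
    removed-edge : ∀ {x y} → (x , y) ∈ Ps → removeEdge A u v x y ≢ false
    removed-edge xy∈ xy-false = true≢false (trans (sym (Ps-edges xy∈)) xy-false)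
    vu∉ : (v , u) ∉ Ps
    vu∉ vu∈ = removed-edge vu∈ (removeEdge-removes′ A u v)
    uv∉ : (u , v) ∉ (v , u) ∷ Ps
    uv∉ (here uv≡vu) = adjacent⇒≢ uv (cong proj₁ uv≡vu)
    uv∉ (there uv∈)  = removed-edge uv∈ (removeEdge-removes A u v)
    edges : ∀ {x y} → (x , y) ∈ (u , v) ∷ (v , u) ∷ Ps → A x y ≡ true
    edges (here refl)         = uv
    edges (there (here refl)) = trans (Graph.sym G v u) uv
    edges (there (there xy∈)) = removeEdge-⊆ A u v _ _ (Ps-edges xy∈)

  not-cut-edge⇒2n≤degreeSum : ∀ u v → A u v ≡ true → ¬ IsCutEdge A u v → 2 * n ≤ degreeSum A
  not-cut-edge⇒2n≤degreeSum u v uv ¬cut with 2 * n ≤? degreeSum A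
  ... | yes 2n≤ = 2n≤
  ... | no  2n≰ = ⊥-elim (¬cut (uv , λ conn → 2n≰ (non-cut-edge⇒2n≤degreeSum u v uv conn)))

  listed-or-unlisted : ∀ (L : List (Fin n × Fin n)) Qs → (∀ {x y} → (x , y) ∈ Qs → A x y ≡ true) →
    (Qs ⊆ L ++ map swap L) ⊎ (Σ (Fin n) λ x → Σ (Fin n) λ y → A x y ≡ true × x Fin.< y × (x , y) ∉ L)
  listed-or-unlisted L []             _   = inj₁ (λ ())
  listed-or-unlisted L ((x , y) ∷ Qs) adj with listed-or-unlisted L Qs (λ xy∈ → adj (there xy∈))
  ... | inj₂ unlisted = inj₂ unlisted
  ... | inj₁ Qs⊆ with FinP.<-cmp x y
  ...   | tri≈ _ x≡y _ = ⊥-elim (adjacent⇒≢ (adj (here refl)) x≡y)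
  ...   | tri< x<y _ _ with DecMembership._∈?_ _≟pair_ (x , y) L
  ...     | yes xy∈ = inj₁ λ { (here refl) → ∈-++⁺ˡ xy∈ ; (there q∈) → Qs⊆ q∈ }
  ...     | no  xy∉ = inj₂ (x , y , adj (here refl) , x<y , xy∉)
  listed-or-unlisted L ((x , y) ∷ Qs) adj | inj₁ Qs⊆ | tri> _ _ y<x
    with DecMembership._∈?_ _≟pair_ (y , x) L
  ...     | yes yx∈ = inj₁ λ { (here refl) → ∈-++⁺ʳ L (∈-map⁺ swap yx∈) ; (there q∈) → Qs⊆ q∈ }
  ...     | no  yx∉ = inj₂ (y , x , trans (Graph.sym G y x) (adj (here refl)) , y<x , yx∉)

  -- (2) With at most n - 3 cut edges, some edge of a spanning tree (which has
  -- n - 1 edges) is not a cut edge, hence Σ d(u) ≥ 2n.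
  few-cut-edges⇒2n≤degreeSum : ∀ {k} → k + 3 ≤ n → Connected A → HasExactlyCutEdges A k →
    2 * n ≤ degreeSum A
  few-cut-edges⇒2n≤degreeSum {k} k+3≤n conn (L , _ , L-length , _ , L-cut)
    with SpanningTree.spanning-pairs A (Graph.sym G) conn root
    where
    root : Fin n
    root = fromℕ< {0} (≤-trans (s≤s z≤n) (≤-trans (m≤n+m 3 k) k+3≤n))
  ... | Ps , Ps-unique , Ps-edges , Ps-length with listed-or-unlisted L Ps Ps-edges
  ...   | inj₂ (x , y , xy , x<y , xy∉) =
    not-cut-edge⇒2n≤degreeSum x y xy (λ cut → xy∉ (Equivalence.from (L-cut x y x<y) cut))
  ...   | inj₁ Ps⊆ = ⊥-elim (<⇒≱ (k+3≤n⇒2k<2[n-1] k+3≤n) (begin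
    2 * (n ∸ 1)                    ≡⟨ sym Ps-length ⟩
    length Ps                      ≤⟨ unique-length-≤ Ps-unique Ps⊆ ⟩
    length (L ++ map swap L)       ≡⟨ length-++ L ⟩
    length L + length (map swap L) ≡⟨ cong₂ _+_ L-length (trans (length-map swap L) L-length) ⟩
    k + k                          ∎))
    where open ≤-Reasoning

-- Pendent vertices and the bound (1).

module Pendent {n : ℕ} (G : Graph n) (conn : Connected (adj G)) (n≥3 : 3 ≤ n) where

  A : Adj n
  A = adj G

  deg : Fin n → ℕ
  deg = degree A

  degree-positive : ∀ u → 1 ≤ deg u
  degree-positive u with missing-vertex (u ∷ []) (≤-trans (s≤s (s≤s z≤n)) n≥3)
  ... | w , w∉ = first-step (conn u w)
    where
    first-step : Reach A u w → 1 ≤ deg u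
    first-step here         = ⊥-elim (w∉ (here refl))
    first-step (step uv _) = subst (1 ≤_) (sym (degree≡length-neighbours A u))
      (unique-length-≤ {xs = _ ∷ []} ([] ∷ []) λ { (here refl) → neighbours⁺ {A = A} uv })

  -- The neighbour of a pendent vertex (for other vertices: any neighbour).
  anchor : Fin n → Fin n
  anchor v = fromMaybe v (head (neighbours A v))

  anchor-adjacent : ∀ {v} → deg v ≡ 1 → A v (anchor v) ≡ true
  anchor-adjacent {v} dv = neighbours⁻ {A = A}
    (proj₁ (sole-member (neighbours A v) v (trans (sym (degree≡length-neighbours A v)) dv)))

  anchor-unique : ∀ {v y} → deg v ≡ 1 → A v y ≡ true → y ≡ anchor v
  anchor-unique {v} dv vy = proj₂ (sole-member (neighbours A v) v
    (trans (sym (degree≡length-neighbours A v)) dv)) (neighbours⁺ {A = A} vy)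

  -- Deleting a pendent edge isolates the pendent vertex, so it is a cut edge.
  pendent-edge-cut : ∀ {v} → deg v ≡ 1 → IsCutEdge A v (anchor v)
  pendent-edge-cut {v} dv = anchor-adjacent dv , λ conn′ →
    adjacent⇒≢ G (anchor-adjacent dv)
      (sym (only-v (closed-reach (v ∷ []) closed (conn′ v (anchor v)) (here refl))))
    where
    only-v : ∀ {z} → z ∈ v ∷ [] → z ≡ v
    only-v (here z≡v) = z≡v
    closed : ∀ {x y} → x ∈ v ∷ [] → removeEdge A v (anchor v) x y ≡ true → y ∈ v ∷ []
    closed {y = y} (here refl) vy with anchor-unique dv (removeEdge-⊆ A v (anchor v) v y vy)
    ... | refl = ⊥-elim (true≢false (trans (sym vy) (removeEdge-removes A v (anchor v))))

  -- Two adjacent pendent vertices would form a whole component, but n ≥ 3.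
  no-adjacent-pendents : ∀ {v w} → deg v ≡ 1 → deg w ≡ 1 → A v w ≡ true → ⊥
  no-adjacent-pendents {v} {w} dv dw vw
    with missing-vertex (v ∷ w ∷ []) (≤-trans (s≤s (s≤s (s≤s z≤n))) n≥3)
  ... | z , z∉ = z∉ (closed-reach (v ∷ w ∷ []) closed (conn v z) (here refl))
    where
    closed : ∀ {x y} → x ∈ v ∷ w ∷ [] → A x y ≡ true → y ∈ v ∷ w ∷ []
    closed {y = y} (here refl) vy = there (here (trans (anchor-unique dv vy) (sym (anchor-unique dv vw))))
    closed {y = y} (there (here refl)) wy =
      here (trans (anchor-unique dw wy) (sym (anchor-unique dw (trans (Graph.sym G w v) vw))))

  pendents : List (Fin n)
  pendents = filter (λ v → deg v ℕ.≟ 1) (allFin n)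

  pendents-unique : Unique pendents
  pendents-unique = Unique.filter⁺ _ (Unique.allFin⁺ n)

  pendents⁺ : ∀ {v} → deg v ≡ 1 → v ∈ pendents
  pendents⁺ {v} dv = ∈-filter⁺ (λ v → deg v ℕ.≟ 1) (∈-allFin v) dv

  pendents⁻ : ∀ {v} → v ∈ pendents → deg v ≡ 1
  pendents⁻ v∈ = proj₂ (∈-filter⁻ (λ v → deg v ℕ.≟ 1) {xs = allFin n} v∈)

  ordered : Fin n → Fin n → Fin n × Fin n
  ordered x y with x Fin.<? y
  ... | yes _ = x , y
  ... | no  _ = y , x

  ordered-cases : ∀ x y → ordered x y ≡ (x , y) ⊎ ordered x y ≡ (y , x)
  ordered-cases x y with x Fin.<? y
  ... | yes _ = inj₁ refl
  ... | no  _ = inj₂ refl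

  ordered-< : ∀ x y → x ≢ y → proj₁ (ordered x y) Fin.< proj₂ (ordered x y)
  ordered-< x y x≢y with x Fin.<? y
  ... | yes x<y = x<y
  ... | no  x≮y = FinP.≤∧≢⇒< (≮⇒≥ x≮y) (λ y≡x → x≢y (sym y≡x))

  ordered-cut : ∀ x y → IsCutEdge A x y → IsCutEdge A (proj₁ (ordered x y)) (proj₂ (ordered x y))
  ordered-cut x y cut with x Fin.<? y
  ... | yes _ = cut
  ... | no  _ = cut-edge-sym G cut

  ordered-injective : ∀ {a b a′ b′} → ordered a b ≡ ordered a′ b′ →
    (a ≡ a′ × b ≡ b′) ⊎ (a ≡ b′ × b ≡ a′)
  ordered-injective {a} {b} {a′} {b′} eq with ordered-cases a b | ordered-cases a′ b′
  ... | inj₁ p | inj₁ q = inj₁ (Product.,-injective (trans (sym p) (trans eq q)))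
  ... | inj₁ p | inj₂ q = inj₂ (Product.,-injective (trans (sym p) (trans eq q)))
  ... | inj₂ p | inj₁ q = inj₂ (swap (Product.,-injective (trans (sym p) (trans eq q))))
  ... | inj₂ p | inj₂ q = inj₁ (swap (Product.,-injective (trans (sym p) (trans eq q))))

  pendentEdge : Fin n → Fin n × Fin n
  pendentEdge v = ordered v (anchor v)

  -- Distinct pendent vertices have distinct pendent edges (they are not adjacent).
  pendentEdge-injective : ∀ {v w} → v ∈ pendents → w ∈ pendents →
    pendentEdge v ≡ pendentEdge w → v ≡ w
  pendentEdge-injective {v} {w} v∈ w∈ eq with ordered-injective eq
  ... | inj₁ (v≡w , _) = v≡w
  ... | inj₂ (v≡aw , av≡w) = ⊥-elim (no-adjacent-pendents (pendents⁻ v∈) (pendents⁻ w∈)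
        (subst (λ z → A v z ≡ true) av≡w (anchor-adjacent (pendents⁻ v∈))))

  pendentEdges : List (Fin n × Fin n)
  pendentEdges = map pendentEdge pendents

  pendentEdges-unique : Unique pendentEdges
  pendentEdges-unique = unique-map pendentEdge pendents-unique pendentEdge-injective

  module CutEdges {k : ℕ} (cuts : HasExactlyCutEdges A k) where

    L : List (Fin n × Fin n)
    L = proj₁ cuts

    L-length : length L ≡ k
    L-length = proj₁ (proj₂ (proj₂ cuts))

    cut-edge-listed : ∀ {x y} → IsCutEdge A x y → ordered x y ∈ L
    cut-edge-listed {x} {y} cut = Equivalence.from
      (proj₂ (proj₂ (proj₂ (proj₂ cuts))) _ _ (ordered-< x y (adjacent⇒≢ G (proj₁ cut))))
      (ordered-cut x y cut)

    pendentEdges⊆L : pendentEdges ⊆ L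
    pendentEdges⊆L e∈ with ∈-map⁻ pendentEdge e∈
    ... | v , v∈ , refl = cut-edge-listed (pendent-edge-cut (pendents⁻ v∈))

    #pendents≤k : length pendents ≤ k
    #pendents≤k = subst₂ _≤_ (length-map pendentEdge pendents) L-length
      (unique-length-≤ pendentEdges-unique pendentEdges⊆L)

-- The arithmetic (3) of degree sequences.

ones : List ℕ → ℕ
ones []             = 0
ones (suc zero ∷ ds) = suc (ones ds)
ones (_ ∷ ds)       = ones ds

atLeast2 : List ℕ → ℕ
atLeast2 []                = 0
atLeast2 (suc (suc _) ∷ ds) = suc (atLeast2 ds)
atLeast2 (_ ∷ ds)          = atLeast2 ds

atLeast3 : List ℕ → ℕ
atLeast3 []                      = 0
atLeast3 (suc (suc (suc _)) ∷ ds) = suc (atLeast3 ds)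
atLeast3 (_ ∷ ds)                = atLeast3 ds

excess : List ℕ → ℕ
excess ds = sum (map (_∸ 2) ds)

Positive : List ℕ → Set
Positive = All (1 ≤_)

length-ones+atLeast2 : ∀ ds → Positive ds → length ds ≡ ones ds + atLeast2 ds
length-ones+atLeast2 []                 []      = refl
length-ones+atLeast2 (suc zero ∷ ds)    (_ ∷ p) = cong suc (length-ones+atLeast2 ds p)
length-ones+atLeast2 (suc (suc d) ∷ ds) (_ ∷ p) =
  trans (cong suc (length-ones+atLeast2 ds p)) (sym (+-suc (ones ds) (atLeast2 ds)))

sum+ones : ∀ ds → Positive ds → sum ds + ones ds ≡ 2 * length ds + excess ds
sum+ones []                 []      = refl
sum+ones (suc zero ∷ ds)    (_ ∷ p) = begin
  suc (sum ds + suc (ones ds))          ≡⟨ cong suc (+-suc (sum ds) (ones ds)) ⟩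
  suc (suc (sum ds + ones ds))          ≡⟨ cong (λ z → suc (suc z)) (sum+ones ds p) ⟩
  suc (suc (2 * length ds + excess ds)) ≡⟨ regroup (length ds) (excess ds) ⟩
  2 * suc (length ds) + excess ds       ∎
  where
  open ≡-Reasoning
  regroup : ∀ l e → suc (suc (2 * l + e)) ≡ 2 * suc l + e
  regroup = solve-∀
sum+ones (suc (suc d) ∷ ds) (_ ∷ p) = begin
  suc (suc d) + sum ds + ones ds          ≡⟨ +-assoc (suc (suc d)) (sum ds) (ones ds) ⟩
  suc (suc d) + (sum ds + ones ds)        ≡⟨ cong (suc (suc d) +_) (sum+ones ds p) ⟩
  suc (suc d) + (2 * length ds + excess ds) ≡⟨ regroup d (length ds) (excess ds) ⟩
  2 * suc (length ds) + (d + excess ds)   ∎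
  where
  open ≡-Reasoning
  regroup : ∀ d l e → suc (suc d) + (2 * l + e) ≡ 2 * suc l + (d + e)
  regroup = solve-∀

-- (2 + d)(2 + e) = 2 (2 + d + e) + d e: merging two excesses costs a factor ≥ 2,
-- and more when both are nonzero.
merge-excess : ∀ d e → 2 * (2 + (d + e)) + d * e ≡ (2 + d) * (2 + e)
merge-excess = solve-∀

merge-excess-≤ : ∀ d e → 2 * (2 + (d + e)) ≤ (2 + d) * (2 + e)
merge-excess-≤ d e = subst (2 * (2 + (d + e)) ≤_) (merge-excess d e) (m≤m+n _ (d * e))

merge-excess-< : ∀ d e → 1 ≤ d → 1 ≤ e → 2 * (2 + (d + e)) < (2 + d) * (2 + e)
merge-excess-< (suc d) (suc e) _ _ =
  subst (2 * (2 + (suc d + suc e)) <_) (merge-excess (suc d) (suc e))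
    (m<m+n _ {suc d * suc e} (s≤s z≤n))

private
  shift-2 : ∀ x y → 2 * x * y ≡ x * (2 * y)
  shift-2 = solve-∀
  swap-factors : ∀ x y z → x * (y * z) ≡ y * (x * z)
  swap-factors = solve-∀

product-bound : ∀ ds → Positive ds → 2 ^ atLeast2 ds * (2 + excess ds) ≤ 2 * product ds
product-bound []                 []      = ≤-refl
product-bound (suc zero ∷ ds)    (_ ∷ p) =
  subst (2 ^ atLeast2 ds * (2 + excess ds) ≤_) (cong (2 *_) (sym (+-identityʳ (product ds)))) (product-bound ds p)
product-bound (suc (suc d) ∷ ds) (_ ∷ p) = begin
  2 * 2 ^ q * (2 + (d + e))    ≡⟨ shift-2 (2 ^ q) (2 + (d + e)) ⟩
  2 ^ q * (2 * (2 + (d + e)))  ≤⟨ *-monoʳ-≤ (2 ^ q) (merge-excess-≤ d e) ⟩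
  2 ^ q * ((2 + d) * (2 + e))  ≡⟨ swap-factors (2 ^ q) (2 + d) (2 + e) ⟩
  (2 + d) * (2 ^ q * (2 + e))  ≤⟨ *-monoʳ-≤ (2 + d) (product-bound ds p) ⟩
  (2 + d) * (2 * product ds)   ≡⟨ swap-factors (2 + d) 2 (product ds) ⟩
  2 * ((2 + d) * product ds)   ∎
  where
  open ≤-Reasoning
  q = atLeast2 ds
  e = excess ds

atLeast3⇒excess : ∀ ds → 1 ≤ atLeast3 ds → 1 ≤ excess ds
atLeast3⇒excess (zero ∷ ds)                 b = atLeast3⇒excess ds b
atLeast3⇒excess (suc zero ∷ ds)             b = atLeast3⇒excess ds b
atLeast3⇒excess (suc (suc zero) ∷ ds)       b = atLeast3⇒excess ds b
atLeast3⇒excess (suc (suc (suc d)) ∷ ds)    _ = s≤s z≤n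

product-bound-strict : ∀ ds → Positive ds → 2 ≤ atLeast3 ds →
  2 ^ atLeast2 ds * (2 + excess ds) < 2 * product ds
product-bound-strict (suc zero ∷ ds) (_ ∷ p) b =
  subst (2 ^ atLeast2 ds * (2 + excess ds) <_) (cong (2 *_) (sym (+-identityʳ (product ds))))
    (product-bound-strict ds p b)
product-bound-strict (suc (suc zero) ∷ ds) (_ ∷ p) b = begin-strict
  2 * 2 ^ q * (2 + e)    ≡⟨ *-assoc 2 (2 ^ q) (2 + e) ⟩
  2 * (2 ^ q * (2 + e))  <⟨ *-monoʳ-< 2 (product-bound-strict ds p b) ⟩
  2 * (2 * product ds)   ∎
  where
  open ≤-Reasoning
  q = atLeast2 ds
  e = excess ds
product-bound-strict (suc (suc (suc d)) ∷ ds) (_ ∷ p) (s≤s b) = begin-strict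
  2 * 2 ^ q * (2 + (suc d + e))      ≡⟨ shift-2 (2 ^ q) (2 + (suc d + e)) ⟩
  2 ^ q * (2 * (2 + (suc d + e)))    <⟨ *-monoʳ-< (2 ^ q) {{m^n≢0 2 q}}
                                          (merge-excess-< (suc d) e (s≤s z≤n) (atLeast3⇒excess ds b)) ⟩
  2 ^ q * ((3 + d) * (2 + e))        ≡⟨ swap-factors (2 ^ q) (3 + d) (2 + e) ⟩
  (3 + d) * (2 ^ q * (2 + e))        ≤⟨ *-monoʳ-≤ (3 + d) (product-bound ds p) ⟩
  (3 + d) * (2 * product ds)         ≡⟨ swap-factors (3 + d) 2 (product ds) ⟩
  2 * ((3 + d) * product ds)         ∎
  where
  open ≤-Reasoning
  q = atLeast2 ds
  e = excess ds

excess-none : ∀ ds → atLeast3 ds ≡ 0 → excess ds ≡ 0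
excess-none []                    _ = refl
excess-none (zero ∷ ds)           b = excess-none ds b
excess-none (suc zero ∷ ds)       b = excess-none ds b
excess-none (suc (suc zero) ∷ ds) b = excess-none ds b

excess-single : ∀ ds → atLeast3 ds ≡ 1 → Σ ℕ λ d → d ∈ ds × 3 ≤ d × excess ds ≡ d ∸ 2
excess-single (zero ∷ ds)           b with excess-single ds b
... | d , d∈ , 3≤d , e≡ = d , there d∈ , 3≤d , e≡
excess-single (suc zero ∷ ds)       b with excess-single ds b
... | d , d∈ , 3≤d , e≡ = d , there d∈ , 3≤d , e≡
excess-single (suc (suc zero) ∷ ds) b with excess-single ds b
... | d , d∈ , 3≤d , e≡ = d , there d∈ , 3≤d , e≡
excess-single (suc (suc (suc d)) ∷ ds) b =
  3 + d , here refl , s≤s (s≤s (s≤s z≤n)) ,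
  trans (cong (suc d +_) (excess-none ds (suc-injective b))) (+-identityʳ (suc d))

mutual
  trade : ∀ a j p → 2 ^ a * (2 + (p + j)) ≤ 2 ^ (a + j) * (2 + p)
  trade a zero    p = ≤-reflexive (cong₂ (λ x y → 2 ^ x * (2 + y)) (sym (+-identityʳ a)) (+-identityʳ p))
  trade a (suc j) p = <⇒≤ (trade-strict a j p)

  trade-strict : ∀ a j p → 2 ^ a * (2 + (p + suc j)) < 2 ^ (a + suc j) * (2 + p)
  trade-strict a j p = begin-strict
    2 ^ a * (2 + (p + suc j))    <⟨ *-monoʳ-< (2 ^ a) {{m^n≢0 2 a}} one-unit ⟩
    2 ^ a * (2 * (2 + (p + j)))  ≡⟨ sym (shift-2 (2 ^ a) (2 + (p + j))) ⟩
    2 * 2 ^ a * (2 + (p + j))    ≡⟨ *-assoc 2 (2 ^ a) (2 + (p + j)) ⟩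
    2 * (2 ^ a * (2 + (p + j)))  ≤⟨ *-monoʳ-≤ 2 (trade a j p) ⟩
    2 * (2 ^ (a + j) * (2 + p))  ≡⟨ sym (*-assoc 2 (2 ^ (a + j)) (2 + p)) ⟩
    2 ^ suc (a + j) * (2 + p)    ≡⟨ cong (λ x → 2 ^ x * (2 + p)) (sym (+-suc a j)) ⟩
    2 ^ (a + suc j) * (2 + p)    ∎
    where
    open ≤-Reasoning
    one-unit : 2 + (p + suc j) < 2 * (2 + (p + j))
    one-unit = subst (2 + (p + suc j) <_) (sym (unfold p j)) (m≤m+n _ (p + j))
      where
      unfold : ∀ p j → 2 * (2 + (p + j)) ≡ suc (2 + (p + suc j)) + (p + j)
      unfold = solve-∀

square-product : ∀ a b → a ^ 2 * b ^ 2 ≡ (a * b) ^ 2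
square-product a b = expanded a b
  where
  expanded : ∀ a b → a * (a * 1) * (b * (b * 1)) ≡ a * b * (a * b * 1)
  expanded = solve-∀

product-squares : ∀ {X : Set} (f : X → ℕ) xs → product (map (λ x → f x ^ 2) xs) ≡ product (map f xs) ^ 2
product-squares f []       = refl
product-squares f (x ∷ xs) = trans (cong (f x ^ 2 *_) (product-squares f xs))
  (square-product (f x) (product (map f xs)))

bound-as-square : ∀ a b → 4 ^ a * b ^ 2 ≡ (2 ^ a * b) ^ 2
bound-as-square a b = trans (cong (_* b ^ 2) four^a) (square-product (2 ^ a) b)
  where
  four^a : 4 ^ a ≡ (2 ^ a) ^ 2
  four^a = trans (^-*-assoc 2 2 a) (trans (cong (2 ^_) (*-comm 2 a)) (sym (^-*-assoc 2 a 2)))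

square-injective : ∀ {a b} → a ^ 2 ≡ b ^ 2 → a ≡ b
square-injective {a} {b} eq with <-cmp a b
... | tri< a<b _ _ = ⊥-elim (<-irrefl eq (^-monoˡ-< 2 a<b))
... | tri≈ _ a≡b _ = a≡b
... | tri> _ _ b<a = ⊥-elim (<-irrefl (sym eq) (^-monoˡ-< 2 b<a))

ones-map : ∀ {X : Set} (f : X → ℕ) xs → ones (map f xs) ≡ length (filter (λ x → f x ℕ.≟ 1) xs)
ones-map f []       = refl
ones-map f (x ∷ xs) with f x
... | zero        = ones-map f xs
... | suc zero    = cong suc (ones-map f xs)
... | suc (suc _) = ones-map f xs

atLeast3-map : ∀ {X : Set} (f : X → ℕ) xs → atLeast3 (map f xs) ≡ length (filter (λ x → 3 ≤? f x) xs)
atLeast3-map f []       = refl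
atLeast3-map f (x ∷ xs) with f x
... | zero              = atLeast3-map f xs
... | suc zero          = atLeast3-map f xs
... | suc (suc zero)    = atLeast3-map f xs
... | suc (suc (suc _)) = cong suc (atLeast3-map f xs)

productOfDegrees : ∀ {n} → Adj n → ℕ
productOfDegrees {n} A = product (map (degree A) (allFin n))

Π₁≡square : ∀ {n} (G : Graph n) → Π₁ G ≡ productOfDegrees (adj G) ^ 2
Π₁≡square {n} G = product-squares (degree (adj G)) (allFin n)

k+3≤n⇒3≤n∸k : ∀ {k n} → k + 3 ≤ n → 3 ≤ n ∸ k
k+3≤n⇒3≤n∸k {k} {n} k+3≤n = subst (_≤ n ∸ k) (m+n∸m≡n k 3) (∸-monoˡ-≤ k k+3≤n)

module LowerBound (n k : ℕ) (1≤k : 1 ≤ k) (k+3≤n : k + 3 ≤ n) (G : Graph n)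
                  (conn : Connected (adj G)) (cuts : HasExactlyCutEdges (adj G) k) where

  k≤n : k ≤ n
  k≤n = ≤-trans (m≤m+n k 3) k+3≤n

  n≥3 : 3 ≤ n
  n≥3 = ≤-trans (m≤n+m 3 k) k+3≤n

  open Pendent G conn n≥3 public
  open CutEdges cuts public

  degrees : List ℕ
  degrees = map deg (allFin n)

  degrees-positive : Positive degrees
  degrees-positive = map⁺ (All.tabulate λ {u} _ → degree-positive u)

  Π : ℕ
  Π = productOfDegrees A

  p q e : ℕ
  p = length pendents
  q = atLeast2 degrees
  e = excess degrees

  length-degrees : length degrees ≡ n
  length-degrees = trans (length-map deg (allFin n)) (length-tabulate {n = n} (λ i → i))

  ones-degrees : ones degrees ≡ p
  ones-degrees = ones-map deg (allFin n)

  n≡p+q : n ≡ p + q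
  n≡p+q = trans (sym length-degrees)
    (trans (length-ones+atLeast2 degrees degrees-positive) (cong (_+ q) ones-degrees))

  -- (2) Σ d(u) ≥ 2n, equivalently p ≤ e.
  p≤e : p ≤ e
  p≤e = +-cancelˡ-≤ (2 * n) p e (begin
    2 * n + p           ≡⟨ +-comm (2 * n) p ⟩
    p + 2 * n           ≤⟨ +-monoʳ-≤ p (few-cut-edges⇒2n≤degreeSum G k+3≤n conn cuts) ⟩
    p + sum degrees     ≡⟨ +-comm p (sum degrees) ⟩
    sum degrees + p     ≡⟨ cong (sum degrees +_) (sym ones-degrees) ⟩
    sum degrees + ones degrees ≡⟨ sum+ones degrees degrees-positive ⟩
    2 * length degrees + e     ≡⟨ cong (λ l → 2 * l + e) length-degrees ⟩
    2 * n + e           ∎)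
    where open ≤-Reasoning

  -- a = n - k non-pendent vertices in Cₙˢ; j = k - p missing pendent vertices.
  a j : ℕ
  a = n ∸ k
  j = k ∸ p

  k≡p+j : k ≡ p + j
  k≡p+j = sym (m+[n∸m]≡n #pendents≤k)

  q≡a+j : q ≡ a + j
  q≡a+j = +-cancelˡ-≡ p q (a + j) (begin
    p + q            ≡⟨ sym n≡p+q ⟩
    n                ≡⟨ sym (m∸n+n≡m k≤n) ⟩
    a + k            ≡⟨ cong (a +_) k≡p+j ⟩
    a + (p + j)      ≡⟨ sym (+-assoc a p j) ⟩
    a + p + j        ≡⟨ cong (_+ j) (+-comm a p) ⟩
    p + a + j        ≡⟨ +-assoc p a j ⟩
    p + (a + j)      ∎)
    where open ≡-Reasoning

  trade-step : 2 ^ a * (2 + k) ≤ 2 ^ q * (2 + p)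
  trade-step = subst₂ (λ x y → 2 ^ a * (2 + x) ≤ 2 ^ y * (2 + p)) (sym k≡p+j) (sym q≡a+j) (trade a j p)

  excess-step : 2 ^ q * (2 + p) ≤ 2 ^ q * (2 + e)
  excess-step = *-monoʳ-≤ (2 ^ q) (+-monoʳ-≤ 2 p≤e)

  product-step : 2 ^ q * (2 + e) ≤ 2 * Π
  product-step = product-bound degrees degrees-positive

  bound : ℕ
  bound = 2 ^ (n ∸ k ∸ 1) * (k + 2)

  2·bound : 2 * bound ≡ 2 ^ a * (2 + k)
  2·bound = trans (sym (*-assoc 2 (2 ^ (a ∸ 1)) (k + 2)))
    (cong₂ _*_ (cong (2 ^_) (m+[n∸m]≡n (≤-trans (s≤s z≤n) (k+3≤n⇒3≤n∸k k+3≤n)))) (+-comm k 2))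

  bound≤Π : bound ≤ Π
  bound≤Π = *-cancelˡ-≤ 2 (subst (_≤ 2 * Π) (sym 2·bound)
    (≤-trans trade-step (≤-trans excess-step product-step)))

  -- When Π = bound every step of the chain is tight: p = k (trade-step is strict
  -- otherwise), e = p, and at most one degree is ≥ 3 (product-step is strict otherwise).
  module Tight (Π≡bound : Π ≡ bound) where

    2Π≡ : 2 * Π ≡ 2 ^ a * (2 + k)
    2Π≡ = trans (cong (2 *_) Π≡bound) 2·bound

    p≡k : p ≡ k
    p≡k with j in j≡
    ... | zero   = trans (sym (+-identityʳ p)) (trans (cong (p +_) (sym j≡)) (sym k≡p+j))
    ... | suc j′ = ⊥-elim (<-irrefl (sym 2Π≡) (<-≤-trans
          (subst₂ (λ x y → 2 ^ a * (2 + x) < 2 ^ y * (2 + p))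
             (trans (cong (p +_) (sym j≡)) (sym k≡p+j)) (trans (cong (a +_) (sym j≡)) (sym q≡a+j))
             (trade-strict a j′ p))
          (≤-trans excess-step product-step)))

    e≡k : e ≡ k
    e≡k = trans (≤-antisym (+-cancelˡ-≤ 2 e p (*-cancelˡ-≤ (2 ^ q) {{m^n≢0 2 q}}
            (≤-trans product-step (≤-trans (≤-reflexive 2Π≡) trade-step)))) p≤e) p≡k

    atLeast3≤1 : atLeast3 degrees ≤ 1
    atLeast3≤1 with 2 ≤? atLeast3 degrees
    ... | no  ≱2 = ≤-pred (≰⇒> ≱2)
    ... | yes ≥2 = ⊥-elim (<-irrefl (sym 2Π≡)
          (≤-trans (s≤s (≤-trans trade-step excess-step)) (product-bound-strict degrees degrees-positive ≥2)))

-- The structure of G when ∏ d(u) = 2^(n-k-1) (k+2).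

module Extremal (n k : ℕ) (1≤k : 1 ≤ k) (k+3≤n : k + 3 ≤ n) (G : Graph n)
                (conn : Connected (adj G)) (cuts : HasExactlyCutEdges (adj G) k)
                (Π≡bound : LowerBound.Π n k 1≤k k+3≤n G conn cuts
                                    ≡ LowerBound.bound n k 1≤k k+3≤n G conn cuts) where

  open LowerBound n k 1≤k k+3≤n G conn cuts public
  open Tight Π≡bound public

  -- Since e = k ≥ 1 there is an entry ≥ 3, and by tightness exactly one.
  one-large-degree : atLeast3 degrees ≡ 1
  one-large-degree with atLeast3 degrees in ≡0 | atLeast3≤1
  ... | zero     | _ = ⊥-elim (<-irrefl refl (≤-trans 1≤k
                        (≤-reflexive (trans (sym e≡k) (excess-none degrees ≡0)))))
  ... | suc zero | _ = refl
  ... | suc (suc _) | s≤s ()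

  -- The centre: a vertex of degree k + 2 (the entry ≥ 3, whose excess is e = k).
  centre : Σ (Fin n) λ u → deg u ≡ k + 2
  centre with excess-single degrees one-large-degree
  ... | d , d∈ , 3≤d , e≡d∸2 with ∈-map⁻ deg d∈
  ...   | u , _ , refl = u , (begin
    deg u           ≡⟨ sym (m∸n+n≡m (≤-trans (n≤1+n 2) 3≤d)) ⟩
    deg u ∸ 2 + 2   ≡⟨ cong (_+ 2) (trans (sym e≡d∸2) e≡k) ⟩
    k + 2           ∎)
    where open ≡-Reasoning

  c : Fin n
  c = proj₁ centre

  deg-c : deg c ≡ k + 2
  deg-c = proj₂ centre

  3≤deg-c : 3 ≤ deg c
  3≤deg-c = subst (3 ≤_) (sym deg-c) (+-monoˡ-≤ 2 1≤k)

  c-not-pendent : deg c ≢ 1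
  c-not-pendent dc with subst (3 ≤_) dc 3≤deg-c
  ... | s≤s ()

  only-c-large : ∀ v → 3 ≤ deg v → v ≡ c
  only-c-large v 3≤dv with v FinP.≟ c
  ... | yes v≡c = v≡c
  ... | no  v≢c = ⊥-elim (<-irrefl refl (≤-trans
        (unique-length-≤ {xs = v ∷ c ∷ []} (unique-cons (unique-cons [] λ ()) λ { (here v≡c) → v≢c v≡c })
          λ { (here refl) → ∈-filter⁺ (λ x → 3 ≤? deg x) (∈-allFin v) 3≤dv
            ; (there (here refl)) → ∈-filter⁺ (λ x → 3 ≤? deg x) (∈-allFin c) 3≤deg-c })
        (≤-reflexive (trans (sym (atLeast3-map deg (allFin n))) one-large-degree))))

  degree-2 : ∀ w → w ≢ c → deg w ≢ 1 → deg w ≡ 2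
  degree-2 w w≢c dw≢1 with deg w in dw≡ | degree-positive w
  ... | suc zero          | _ = ⊥-elim (dw≢1 refl)
  ... | suc (suc zero)    | _ = refl
  ... | suc (suc (suc _)) | _ = ⊥-elim (w≢c (only-c-large w (subst (3 ≤_) (sym dw≡) (s≤s (s≤s (s≤s z≤n))))))

  -- There are k pendent vertices, so every cut edge is a pendent edge.
  L⊆pendentEdges : L ⊆ pendentEdges
  L⊆pendentEdges = unique-⊆-long⇒⊇ _≟pair_ pendentEdges-unique pendentEdges⊆L
    (≤-reflexive (trans L-length (trans (sym p≡k) (sym (length-map pendentEdge pendents)))))

  other-neighbour : ∀ w v → deg w ≡ 2 → A w v ≡ true →
    Σ (Fin n) λ x → A w x ≡ true × x ≢ v × (∀ y → A w y ≡ true → y ≡ v ⊎ y ≡ x)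
  other-neighbour w v dw wv
    with otherThan-spec FinP._≟_ w (neighbours A w) (trans (sym (degree≡length-neighbours A w)) dw)
                   (neighbours-unique A w) (neighbours⁺ {A = A} wv)
  ... | x∈ , x≢v , only = _ , neighbours⁻ {A = A} x∈ , x≢v , λ y wy → only (neighbours⁺ {A = A} wy)

  path-edge-cut : ∀ v w x → deg v ≡ 1 → A v w ≡ true → A w x ≡ true → x ≢ v →
    (∀ y → A w y ≡ true → y ≡ v ⊎ y ≡ x) → IsCutEdge A w x
  path-edge-cut v w x dv vw wx x≢v only = wx , λ conn′ →
    outside (closed-reach (v ∷ w ∷ []) closed (conn′ v x) (here refl))
    where
    outside : x ∉ v ∷ w ∷ []
    outside (here x≡v)         = x≢v x≡v
    outside (there (here x≡w)) = adjacent⇒≢ G wx (sym x≡w)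
    closed : ∀ {a b} → a ∈ v ∷ w ∷ [] → removeEdge A w x a b ≡ true → b ∈ v ∷ w ∷ []
    closed {b = b} (here refl) vb =
      there (here (trans (anchor-unique dv (removeEdge-⊆ A w x v b vb)) (sym (anchor-unique dv vw))))
    closed {b = b} (there (here refl)) wb with only b (removeEdge-⊆ A w x w b wb)
    ... | inj₁ b≡v = here b≡v
    ... | inj₂ refl = ⊥-elim (true≢false (trans (sym wb) (removeEdge-removes A w x)))

  -- Two pendents at a vertex w ≠ c with no further neighbours would form a
  -- component missing c.
  no-isolated-path : ∀ v w x → deg v ≡ 1 → deg x ≡ 1 → A v w ≡ true → A w x ≡ true →
    (∀ y → A w y ≡ true → y ≡ v ⊎ y ≡ x) → w ≢ c → ⊥
  no-isolated-path v w x dv dx vw wx only w≢c =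
    c-outside (closed-reach (v ∷ w ∷ x ∷ []) closed (conn v c) (here refl))
    where
    closed : ∀ {a b} → a ∈ v ∷ w ∷ x ∷ [] → A a b ≡ true → b ∈ v ∷ w ∷ x ∷ []
    closed {b = b} (here refl) vb = there (here (trans (anchor-unique dv vb) (sym (anchor-unique dv vw))))
    closed {b = b} (there (here refl)) wb with only b wb
    ... | inj₁ b≡v = here b≡v
    ... | inj₂ b≡x = there (there (here b≡x))
    closed {b = b} (there (there (here refl))) xb =
      there (here (trans (anchor-unique dx xb) (sym (anchor-unique dx (trans (Graph.sym G x w) wx)))))
    c-outside : c ∉ v ∷ w ∷ x ∷ []
    c-outside (here c≡v)                 = c-not-pendent (trans (cong deg c≡v) dv)
    c-outside (there (here c≡w))         = w≢c (sym c≡w)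
    c-outside (there (there (here c≡x))) = c-not-pendent (trans (cong deg c≡x) dx)

  -- A pendent v cannot hang at a vertex w ≠ c: then w has degree 2, and for its
  -- other neighbour x the edge wx is a cut edge, hence a pendent edge; w is not
  -- pendent, so x is, and {v, w, x} would be a component missing c.
  hangs-only-at-c : ∀ {v w} → deg v ≡ 1 → A v w ≡ true → w ≢ c → ⊥
  hangs-only-at-c {v} {w} dv vw w≢c
    with other-neighbour w v (degree-2 w w≢c (λ dw → no-adjacent-pendents dv dw vw)) (trans (Graph.sym G w v) vw)
  ... | x , wx , x≢v , only
    with ∈-map⁻ pendentEdge (L⊆pendentEdges (cut-edge-listed (path-edge-cut v w x dv vw wx x≢v only)))
  ...   | u , u∈ , wx≡ with ordered-injective wx≡
  ...     | inj₁ (w≡u , _) = no-adjacent-pendents dv (trans (cong deg w≡u) (pendents⁻ u∈)) vw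
  ...     | inj₂ (_ , x≡u) = no-isolated-path v w x dv (trans (cong deg x≡u) (pendents⁻ u∈)) vw wx only w≢c

  anchor≡c : ∀ v → deg v ≡ 1 → anchor v ≡ c
  anchor≡c v dv with anchor v FinP.≟ c
  ... | yes av≡c = av≡c
  ... | no  av≢c = ⊥-elim (hangs-only-at-c dv (anchor-adjacent dv) av≢c)

  pendent-neighbour≡c : ∀ {v y} → deg v ≡ 1 → A v y ≡ true → y ≡ c
  pendent-neighbour≡c {v} dv vy = trans (anchor-unique dv vy) (anchor≡c v dv)

  pendent? : (v : Fin n) → Dec (deg v ≡ 1)
  pendent? v = deg v ℕ.≟ 1

  -- The m = n - k non-pendent vertices, which will form the cycle.
  m : ℕ
  m = n ∸ k

  cycleVertices : List (Fin n)
  cycleVertices = filter (λ v → ¬? (pendent? v)) (allFin n)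

  cycleVertices-unique : Unique cycleVertices
  cycleVertices-unique = Unique.filter⁺ _ (Unique.allFin⁺ n)

  cycleVertices⁺ : ∀ {v} → deg v ≢ 1 → v ∈ cycleVertices
  cycleVertices⁺ {v} dv = ∈-filter⁺ (λ v → ¬? (pendent? v)) (∈-allFin v) dv

  cycleVertices⁻ : ∀ {v} → v ∈ cycleVertices → deg v ≢ 1
  cycleVertices⁻ v∈ = proj₂ (∈-filter⁻ (λ v → ¬? (pendent? v)) {xs = allFin n} v∈)

  length-cycleVertices : length cycleVertices ≡ m
  length-cycleVertices = sym (begin
    n ∸ k                                               ≡⟨ cong (_∸ k) (sym split) ⟩
    length pendents + length cycleVertices ∸ k          ≡⟨ cong (λ l → l + length cycleVertices ∸ k) p≡k ⟩
    k + length cycleVertices ∸ k                        ≡⟨ m+n∸m≡n k (length cycleVertices) ⟩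
    length cycleVertices                                ∎)
    where
    open ≡-Reasoning
    split : length pendents + length cycleVertices ≡ n
    split = trans (length-filter-split pendent? (allFin n)) (length-tabulate {n = n} (λ i → i))

  cycleNeighbours : Fin n → List (Fin n)
  cycleNeighbours u = filter (λ v → ¬? (pendent? v)) (neighbours A u)

  cycleNeighbours-unique : ∀ u → Unique (cycleNeighbours u)
  cycleNeighbours-unique u = Unique.filter⁺ _ (neighbours-unique A u)

  cycleNeighbours⁺ : ∀ {u y} → A u y ≡ true → deg y ≢ 1 → y ∈ cycleNeighbours u
  cycleNeighbours⁺ {u} uy dy = ∈-filter⁺ (λ v → ¬? (pendent? v)) (neighbours⁺ {A = A} uy) dy

  cycleNeighbours⁻ : ∀ {u y} → y ∈ cycleNeighbours u → A u y ≡ true × deg y ≢ 1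
  cycleNeighbours⁻ {u} y∈ with ∈-filter⁻ (λ v → ¬? (pendent? v)) {xs = neighbours A u} y∈
  ... | y∈nbrs , dy = neighbours⁻ {A = A} y∈nbrs , dy

  -- Every non-pendent vertex has exactly two non-pendent neighbours: the centre
  -- has degree k + 2 and all k pendents as neighbours; any other one has degree
  -- 2 and no pendent neighbour.
  length-cycleNeighbours : ∀ u → deg u ≢ 1 → length (cycleNeighbours u) ≡ 2
  length-cycleNeighbours u du = +-cancelˡ-≡ (length pendentNeighbours) _ _
    (trans split (sym (#pendentNeighbours+2 (u FinP.≟ c))))
    where
    pendentNeighbours : List (Fin n)
    pendentNeighbours = filter pendent? (neighbours A u)
    pendentNeighbours-unique : Unique pendentNeighbours
    pendentNeighbours-unique = Unique.filter⁺ _ (neighbours-unique A u)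
    pendentNeighbour⁻ : ∀ {v} → v ∈ pendentNeighbours → deg v ≡ 1 × A u v ≡ true
    pendentNeighbour⁻ v∈ with ∈-filter⁻ pendent? {xs = neighbours A u} v∈
    ... | v∈nbrs , dv = dv , neighbours⁻ {A = A} v∈nbrs
    split : length pendentNeighbours + length (cycleNeighbours u) ≡ deg u
    split = trans (length-filter-split pendent? (neighbours A u)) (sym (degree≡length-neighbours A u))
    #pendentNeighbours+2 : Dec (u ≡ c) → length pendentNeighbours + 2 ≡ deg u
    #pendentNeighbours+2 (yes refl) = trans (cong (_+ 2) (trans all-pendents p≡k)) (sym deg-c)
      where
      all-pendents : length pendentNeighbours ≡ length pendents
      all-pendents = unique-same-members-length pendentNeighbours-unique pendents-unique
        (λ v∈ → pendents⁺ (proj₁ (pendentNeighbour⁻ v∈)))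
        (λ {v} v∈ → ∈-filter⁺ pendent? (neighbours⁺ {A = A}
          (subst (λ z → A z v ≡ true) (anchor≡c v (pendents⁻ v∈))
            (trans (Graph.sym G (anchor v) v) (anchor-adjacent (pendents⁻ v∈))))) (pendents⁻ v∈))
    #pendentNeighbours+2 (no u≢c) = trans (cong (_+ 2) none) (sym (degree-2 u u≢c du))
      where
      none : length pendentNeighbours ≡ 0
      none = n≤0⇒n≡0 (unique-length-≤ {ys = []} pendentNeighbours-unique λ v∈ →
        ⊥-elim (u≢c (pendent-neighbour≡c (proj₁ (pendentNeighbour⁻ v∈))
          (trans (Graph.sym G _ u) (proj₂ (pendentNeighbour⁻ v∈))))))

  -- Start at c, coming from b₀ (a non-pendent
  -- neighbour of c), and always continue to the non-pendent neighbour other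
  -- than the one just left.  The walk returns to c after exactly m steps,
  -- having visited every non-pendent vertex once.
  module CycleWalk where

    b₀ : Fin n
    b₀ = fromMaybe c (head (cycleNeighbours c))

    b₀∈ : b₀ ∈ cycleNeighbours c
    b₀∈ = head-∈ (cycleNeighbours c) c
      (≤-trans (s≤s z≤n) (≤-reflexive (sym (length-cycleNeighbours c c-not-pendent))))

    -- state i = (vertex before step i, vertex at step i)
    state : ℕ → Fin n × Fin n
    state zero    = b₀ , c
    state (suc i) = let (prev , cur) = state i in cur , otherThan FinP._≟_ cur (cycleNeighbours cur) prev

    vertex previous : ℕ → Fin n
    vertex   i = proj₂ (state i)
    previous i = proj₁ (state i)

    invariant : ∀ i → deg (vertex i) ≢ 1 × previous i ∈ cycleNeighbours (vertex i)
    invariant zero    = c-not-pendent , b₀∈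
    invariant (suc i) with invariant i
    ... | dv , prev∈ with otherThan-spec FinP._≟_ (vertex i) (cycleNeighbours (vertex i))
                            (length-cycleNeighbours (vertex i) dv) (cycleNeighbours-unique (vertex i)) prev∈
    ...   | next∈ , _ , _ = proj₂ (cycleNeighbours⁻ next∈) ,
                            cycleNeighbours⁺ (trans (Graph.sym G _ _) (proj₁ (cycleNeighbours⁻ next∈))) dv

    not-pendent : ∀ i → deg (vertex i) ≢ 1
    not-pendent i = proj₁ (invariant i)

    step-spec : ∀ i → vertex (suc i) ∈ cycleNeighbours (vertex i) × vertex (suc i) ≢ previous i ×
      (∀ {y} → y ∈ cycleNeighbours (vertex i) → y ≡ previous i ⊎ y ≡ vertex (suc i))
    step-spec i = otherThan-spec FinP._≟_ (vertex i) (cycleNeighbours (vertex i))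
      (length-cycleNeighbours (vertex i) (not-pendent i)) (cycleNeighbours-unique (vertex i)) (proj₂ (invariant i))

    next∈ : ∀ i → vertex (suc i) ∈ cycleNeighbours (vertex i)
    next∈ i = proj₁ (step-spec i)

    next≢previous : ∀ i → vertex (suc i) ≢ previous i
    next≢previous i = proj₁ (proj₂ (step-spec i))

    two-neighbours : ∀ i {y} → y ∈ cycleNeighbours (vertex i) → y ≡ previous i ⊎ y ≡ vertex (suc i)
    two-neighbours i = proj₂ (proj₂ (step-spec i))

    walk-adjacent : ∀ i → A (vertex i) (vertex (suc i)) ≡ true
    walk-adjacent i = proj₁ (cycleNeighbours⁻ (next∈ i))

    visited : ℕ → List (Fin n)
    visited zero    = []
    visited (suc j) = vertex j ∷ visited j

    visited⁺ : ∀ {i j} → i < j → vertex i ∈ visited j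
    visited⁺ {i} {suc j} i<1+j with m<1+n⇒m<n∨m≡n i<1+j
    ... | inj₁ i<j  = there (visited⁺ i<j)
    ... | inj₂ refl = here refl

    visited⁻ : ∀ {y} j → y ∈ visited j → Σ ℕ λ i → i < j × y ≡ vertex i
    visited⁻ (suc j) (here y≡)  = j , ≤-refl , y≡
    visited⁻ (suc j) (there y∈) with visited⁻ j y∈
    ... | i , i<j , y≡ = i , ≤-trans i<j (n≤1+n j) , y≡

    length-visited : ∀ j → length (visited j) ≡ j
    length-visited zero    = refl
    length-visited (suc j) = cong suc (length-visited j)

    visited⊆cycleVertices : ∀ j → visited j ⊆ cycleVertices
    visited⊆cycleVertices j y∈ with visited⁻ j y∈
    ... | i , _ , refl = cycleVertices⁺ (not-pendent i)

    visited-injective : ∀ j → Unique (visited j) → ∀ {i₁ i₂} → i₁ < j → i₂ < j →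
      vertex i₁ ≡ vertex i₂ → i₁ ≡ i₂
    visited-injective (suc j) (v∉ ∷ u) {i₁} {i₂} i₁< i₂< eq
      with m<1+n⇒m<n∨m≡n i₁< | m<1+n⇒m<n∨m≡n i₂<
    ... | inj₁ i₁<j | inj₁ i₂<j = visited-injective j u i₁<j i₂<j eq
    ... | inj₂ refl | inj₂ refl = refl
    ... | inj₂ refl | inj₁ i₂<j = ⊥-elim (All¬⇒¬Any v∉ (subst (_∈ visited j) (sym eq) (visited⁺ i₂<j)))
    ... | inj₁ i₁<j | inj₂ refl = ⊥-elim (All¬⇒¬Any v∉ (subst (_∈ visited j) eq (visited⁺ i₁<j)))

    first-repeat : ∀ fuel t → fuel + t ≡ m → Unique (visited t) →
      Σ ℕ λ j → Unique (visited j) × vertex j ∈ visited j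
    first-repeat fuel t fuel+t≡m u with DecMembership._∈?_ FinP._≟_ (vertex t) (visited t)
    ... | yes v∈ = t , u , v∈
    ... | no  v∉ with fuel
    ...   | zero = ⊥-elim (<-irrefl refl
      (subst₂ _≤_ (length-visited (suc t)) (trans length-cycleVertices (sym fuel+t≡m))
        (unique-length-≤ (unique-cons u v∉) (visited⊆cycleVertices (suc t)))))
    ...   | suc fuel′ = first-repeat fuel′ (suc t) (trans (+-suc fuel′ t) fuel+t≡m) (unique-cons u v∉)

    ClosesCycle : ℕ → Set
    ClosesCycle j = Σ ℕ λ j′ → j ≡ suc j′ × vertex j ≡ c × vertex j′ ≡ b₀

    -- If vertex (j′+1) = vertex i with i < j′, then vertex j′ is a non-pendent
    -- neighbour of vertex i; it cannot be vertex (i+1) (injectivity) so it is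
    -- previous i, forcing i = 0.
    repeat-earlier : ∀ j′ → Unique (visited (suc j′)) → ∀ i → i < j′ → vertex (suc j′) ≡ vertex i →
      vertex j′ ≡ previous i ⊎ vertex j′ ≡ vertex (suc i) → ClosesCycle (suc j′)
    repeat-earlier j′ u i i<j′ eq (inj₂ eq₂) =
      ⊥-elim (next≢previous (suc i) (trans (cong (λ z → vertex (suc z)) (sym j′≡1+i)) eq))
      where
      j′≡1+i : j′ ≡ suc i
      j′≡1+i = visited-injective (suc j′) u (n<1+n j′) (s≤s i<j′) eq₂
    repeat-earlier j′ u zero     _    eq (inj₁ eq₁) = j′ , refl , eq , eq₁
    repeat-earlier j′ u (suc i′) i<j′ eq (inj₁ eq₁) = ⊥-elim (<-irrefl (sym j′≡i′) (≤-trans (n≤1+n _) i<j′))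
      where
      j′≡i′ : j′ ≡ i′
      j′≡i′ = visited-injective (suc j′) u (n<1+n j′) (≤-trans (n≤1+n _) (≤-trans i<j′ (n≤1+n j′))) eq₁

    repeat-closes : ∀ j → Unique (visited j) → vertex j ∈ visited j → ClosesCycle j
    repeat-closes (suc j′) u v∈ with visited⁻ (suc j′) v∈
    ... | i , i<1+j′ , eq with m<1+n⇒m<n∨m≡n i<1+j′
    ...   | inj₂ refl = ⊥-elim (adjacent⇒≢ G (walk-adjacent i) (sym eq))
    ...   | inj₁ i<j′ = repeat-earlier j′ u i i<j′ eq (two-neighbours i
      (subst (λ z → vertex j′ ∈ cycleNeighbours z) eq
        (cycleNeighbours⁺ (trans (Graph.sym G _ _) (walk-adjacent j′)) (not-pendent j′))))

    period : ℕ
    period = proj₁ (first-repeat m 0 (+-identityʳ m) [])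

    period-unique : Unique (visited period)
    period-unique = proj₁ (proj₂ (first-repeat m 0 (+-identityʳ m) []))

    period-closes : ClosesCycle period
    period-closes = repeat-closes period period-unique (proj₂ (proj₂ (first-repeat m 0 (+-identityʳ m) [])))

    period′ : ℕ
    period′ = proj₁ period-closes

    period≡1+period′ : period ≡ suc period′
    period≡1+period′ = proj₁ (proj₂ period-closes)

    vertex-period : vertex period ≡ c
    vertex-period = proj₁ (proj₂ (proj₂ period-closes))

    vertex-before-period : vertex period′ ≡ b₀
    vertex-before-period = proj₂ (proj₂ (proj₂ period-closes))

    private
      0<period : 0 < period
      0<period = subst (0 <_) (sym period≡1+period′) (s≤s z≤n)

      c∈visited : c ∈ visited period
      c∈visited = visited⁺ 0<period

      b₀∈visited : b₀ ∈ visited period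
      b₀∈visited = subst (_∈ visited period) vertex-before-period
        (visited⁺ (subst (period′ <_) (sym period≡1+period′) (n<1+n period′)))

      -- Both cycle neighbours of a visited vertex are visited: vertex period = c
      -- closes the walk forwards and previous 0 = b₀ backwards.
      next-visited : ∀ {i} → i < period → vertex (suc i) ∈ visited period
      next-visited i<period with m≤n⇒m<n∨m≡n i<period
      ... | inj₁ 1+i<period = visited⁺ 1+i<period
      ... | inj₂ 1+i≡period =
        subst (_∈ visited period) (trans (sym vertex-period) (cong vertex (sym 1+i≡period))) c∈visited

      previous-visited : ∀ {i} → i < period → previous i ∈ visited period
      previous-visited {zero}  _        = b₀∈visited
      previous-visited {suc i} i<period = visited⁺ (≤-trans (n≤1+n _) i<period)

      -- Hence the visited vertices together with the pendents (all hanging at c)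
      -- are closed under adjacency.
      closed : ∀ {x y} → x ∈ visited period ++ pendents → A x y ≡ true → y ∈ visited period ++ pendents
      closed {x} {y} x∈ xy with ∈-++⁻ (visited period) x∈
      ... | inj₂ x∈pendents =
        ∈-++⁺ˡ (subst (_∈ visited period) (sym (pendent-neighbour≡c (pendents⁻ x∈pendents) xy)) c∈visited)
      ... | inj₁ x∈visited with pendent? y
      ...   | yes dy = ∈-++⁺ʳ (visited period) (pendents⁺ dy)
      ...   | no  dy with visited⁻ period x∈visited
      ...     | i , i<period , refl with two-neighbours i (cycleNeighbours⁺ xy dy)
      ...       | inj₁ refl = ∈-++⁺ˡ (previous-visited i<period)
      ...       | inj₂ refl = ∈-++⁺ˡ (next-visited i<period)

      cycleVertices⊆visited : cycleVertices ⊆ visited period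
      cycleVertices⊆visited {z} z∈
        with ∈-++⁻ (visited period) (closed-reach (visited period ++ pendents) closed (conn c z) (∈-++⁺ˡ c∈visited))
      ... | inj₁ z∈visited  = z∈visited
      ... | inj₂ z∈pendents = ⊥-elim (cycleVertices⁻ z∈ (pendents⁻ z∈pendents))

    period≡m : period ≡ m
    period≡m = begin
      period                 ≡⟨ sym (length-visited period) ⟩
      length (visited period) ≡⟨ unique-same-members-length period-unique cycleVertices-unique
                                   (visited⊆cycleVertices period) cycleVertices⊆visited ⟩
      length cycleVertices   ≡⟨ length-cycleVertices ⟩
      m                      ∎
      where open ≡-Reasoning

    vertex-injective : ∀ {i₁ i₂} → i₁ < m → i₂ < m → vertex i₁ ≡ vertex i₂ → i₁ ≡ i₂
    vertex-injective i₁<m i₂<m = visited-injective period period-unique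
      (subst (_ <_) (sym period≡m) i₁<m) (subst (_ <_) (sym period≡m) i₂<m)

    vertex-surjective : ∀ z → deg z ≢ 1 → Σ ℕ λ i → i < m × z ≡ vertex i
    vertex-surjective z dz with visited⁻ period (cycleVertices⊆visited (cycleVertices⁺ dz))
    ... | i , i<period , z≡ = i , subst (i <_) period≡m i<period , z≡

    vertex-m : vertex m ≡ c
    vertex-m = subst (λ z → vertex z ≡ c) period≡m vertex-period

    previous-0 : previous 0 ≡ vertex (m ∸ 1)
    previous-0 = sym (trans (cong vertex (trans (cong (_∸ 1) (sym period≡m)) (cong (_∸ 1) period≡1+period′)))
      vertex-before-period)

CycleEdge : ℕ → ℕ → ℕ → Set
CycleEdge m a b = b ≡ suc a ⊎ a ≡ suc b ⊎ (a ≡ 0 × b ≡ m ∸ 1) ⊎ (b ≡ 0 × a ≡ m ∸ 1)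

CSEdge : ℕ → ℕ → ℕ → Set
CSEdge m a b = (a < m × b < m × CycleEdge m a b) ⊎ (a ≡ 0 × m ≤ b) ⊎ (b ≡ 0 × m ≤ a)

private
  T⇒≡true : ∀ {x} → T x → x ≡ true
  T⇒≡true = Equivalence.to Bool.T-≡

  ≡true⇒T : ∀ {x} → x ≡ true → T x
  ≡true⇒T = Equivalence.from Bool.T-≡

  <ᵇ-false : ∀ a b → (a <ᵇ b) ≡ false → b ≤ a
  <ᵇ-false a b a≮b = ≮⇒≥ λ a<b → subst T a≮b (<⇒<ᵇ a<b)

  <ᵇ-false⁺ : ∀ {a b} → b ≤ a → (a <ᵇ b) ≡ false
  <ᵇ-false⁺ {a} {b} b≤a with a <ᵇ b in a<b
  ... | false = refl
  ... | true  = ⊥-elim (<⇒≱ (<ᵇ⇒< a b (≡true⇒T a<b)) b≤a)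

  ∨-introˡ : ∀ {x} y → T x → T (x ∨ y)
  ∨-introˡ {true} _ _ = tt

  ∨-introʳ : ∀ x {y} → T y → T (x ∨ y)
  ∨-introʳ true  _ = tt
  ∨-introʳ false t = t

  ∨-cases : ∀ {x y} → T (x ∨ y) → T x ⊎ T y
  ∨-cases = Equivalence.to Bool.T-∨

  ∧-parts : ∀ {x y} → T (x ∧ y) → T x × T y
  ∧-parts = Equivalence.to Bool.T-∧

  ≡ᵇ-pair : ∀ {a b c d} → T ((a ≡ᵇ b) ∧ (c ≡ᵇ d)) → a ≡ b × c ≡ d
  ≡ᵇ-pair {a} {b} {c} {d} t with ∧-parts t
  ... | t₁ , t₂ = ≡ᵇ⇒≡ a b t₁ , ≡ᵇ⇒≡ c d t₂

csAdjℕ-sound : ∀ n k a b → csAdjℕ n k a b ≡ true → CSEdge (n ∸ k) a b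
csAdjℕ-sound n k a b adj with a <ᵇ n ∸ k in a<m | b <ᵇ n ∸ k in b<m
... | true  | true  = inj₁ (<ᵇ⇒< a _ (≡true⇒T a<m) , <ᵇ⇒< b _ (≡true⇒T b<m) , cycle (≡true⇒T adj))
  where
  cycle : T ((b ≡ᵇ suc a) ∨ (a ≡ᵇ suc b) ∨ ((a ≡ᵇ 0) ∧ (b ≡ᵇ n ∸ k ∸ 1)) ∨ ((b ≡ᵇ 0) ∧ (a ≡ᵇ n ∸ k ∸ 1))) →
    CycleEdge (n ∸ k) a b
  cycle t with ∨-cases t
  ... | inj₁ t₁ = inj₁ (≡ᵇ⇒≡ b (suc a) t₁)
  ... | inj₂ t₂ with ∨-cases t₂
  ...   | inj₁ t₃ = inj₂ (inj₁ (≡ᵇ⇒≡ a (suc b) t₃))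
  ...   | inj₂ t₄ with ∨-cases t₄
  ...     | inj₁ t₅ = inj₂ (inj₂ (inj₁ (≡ᵇ-pair t₅)))
  ...     | inj₂ t₆ = inj₂ (inj₂ (inj₂ (≡ᵇ-pair t₆)))
... | true  | false = star (∨-cases (≡true⇒T adj))
  where
  star : T ((a ≡ᵇ 0) ∧ true) ⊎ T ((b ≡ᵇ 0) ∧ false) → CSEdge (n ∸ k) a b
  star (inj₁ t) = inj₂ (inj₁ (≡ᵇ⇒≡ a 0 (proj₁ (∧-parts t)) , <ᵇ-false b _ b<m))
  star (inj₂ t) = ⊥-elim (proj₂ (∧-parts t))
... | false | true  = star (∨-cases (≡true⇒T adj))
  where
  star : T ((a ≡ᵇ 0) ∧ false) ⊎ T ((b ≡ᵇ 0) ∧ true) → CSEdge (n ∸ k) a b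
  star (inj₁ t) = ⊥-elim (proj₂ (∧-parts t))
  star (inj₂ t) = inj₂ (inj₂ (≡ᵇ⇒≡ b 0 (proj₁ (∧-parts t)) , <ᵇ-false a _ a<m))
... | false | false = star (∨-cases (≡true⇒T adj))
  where
  star : T ((a ≡ᵇ 0) ∧ true) ⊎ T ((b ≡ᵇ 0) ∧ true) → CSEdge (n ∸ k) a b
  star (inj₁ t) = inj₂ (inj₁ (≡ᵇ⇒≡ a 0 (proj₁ (∧-parts t)) , <ᵇ-false b _ b<m))
  star (inj₂ t) = inj₂ (inj₂ (≡ᵇ⇒≡ b 0 (proj₁ (∧-parts t)) , <ᵇ-false a _ a<m))

csAdjℕ-complete : ∀ n k a b → CSEdge (n ∸ k) a b → csAdjℕ n k a b ≡ true
csAdjℕ-complete n k a b (inj₁ (a<m , b<m , cyc))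
  rewrite T⇒≡true (<⇒<ᵇ a<m) | T⇒≡true (<⇒<ᵇ b<m) = T⇒≡true (cycle cyc)
  where
  cycle : CycleEdge (n ∸ k) a b →
    T ((b ≡ᵇ suc a) ∨ (a ≡ᵇ suc b) ∨ ((a ≡ᵇ 0) ∧ (b ≡ᵇ n ∸ k ∸ 1)) ∨ ((b ≡ᵇ 0) ∧ (a ≡ᵇ n ∸ k ∸ 1)))
  cycle (inj₁ b≡1+a) = ∨-introˡ _ (≡⇒≡ᵇ b (suc a) b≡1+a)
  cycle (inj₂ (inj₁ a≡1+b)) = ∨-introʳ (b ≡ᵇ suc a) (∨-introˡ _ (≡⇒≡ᵇ a (suc b) a≡1+b))
  cycle (inj₂ (inj₂ (inj₁ (a≡0 , b≡m-1)))) = ∨-introʳ (b ≡ᵇ suc a) (∨-introʳ (a ≡ᵇ suc b)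
    (∨-introˡ _ (Equivalence.from Bool.T-∧ (≡⇒≡ᵇ a 0 a≡0 , ≡⇒≡ᵇ b _ b≡m-1))))
  cycle (inj₂ (inj₂ (inj₂ (b≡0 , a≡m-1)))) = ∨-introʳ (b ≡ᵇ suc a) (∨-introʳ (a ≡ᵇ suc b)
    (∨-introʳ ((a ≡ᵇ 0) ∧ (b ≡ᵇ n ∸ k ∸ 1)) (Equivalence.from Bool.T-∧ (≡⇒≡ᵇ b 0 b≡0 , ≡⇒≡ᵇ a _ a≡m-1))))
csAdjℕ-complete n k .0 b (inj₂ (inj₁ (refl , m≤b)))
  rewrite <ᵇ-false⁺ m≤b | Bool.∧-zeroʳ (0 <ᵇ n ∸ k) = refl
csAdjℕ-complete n k a .0 (inj₂ (inj₂ (refl , m≤a)))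
  rewrite <ᵇ-false⁺ m≤a = T⇒≡true (∨-introʳ ((a ≡ᵇ 0) ∧ not (0 <ᵇ n ∸ k)) tt)

-- Extremal graphs are isomorphic to Cₙˢ.

module _ {a} {X : Set a} where

  nth : List X → ℕ → X → X
  nth []       _       d = d
  nth (x ∷ xs) zero    _ = x
  nth (x ∷ xs) (suc t) d = nth xs t d

  nth-∈ : ∀ (xs : List X) t d → t < length xs → nth xs t d ∈ xs
  nth-∈ (x ∷ xs) zero    _ _         = here refl
  nth-∈ (x ∷ xs) (suc t) d (s≤s t<) = there (nth-∈ xs t d t<)

  nth-injective : ∀ (xs : List X) d → Unique xs → ∀ {t₁ t₂} → t₁ < length xs → t₂ < length xs →
    nth xs t₁ d ≡ nth xs t₂ d → t₁ ≡ t₂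
  nth-injective (x ∷ xs) d _        {zero}   {zero}   _          _          _  = refl
  nth-injective (x ∷ xs) d (x∉ ∷ _) {zero}   {suc t₂} _          (s≤s t₂<) eq =
    ⊥-elim (All¬⇒¬Any x∉ (subst (_∈ xs) (sym eq) (nth-∈ xs t₂ d t₂<)))
  nth-injective (x ∷ xs) d (x∉ ∷ _) {suc t₁} {zero}   (s≤s t₁<) _          eq =
    ⊥-elim (All¬⇒¬Any x∉ (subst (_∈ xs) eq (nth-∈ xs t₁ d t₁<)))
  nth-injective (x ∷ xs) d (_ ∷ u)  {suc t₁} {suc t₂} (s≤s t₁<) (s≤s t₂<) eq =
    cong suc (nth-injective xs d u t₁< t₂< eq)

  nth-index : ∀ {x : X} (xs : List X) d → x ∈ xs → Σ ℕ λ t → t < length xs × x ≡ nth xs t d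
  nth-index (y ∷ xs) d (here x≡y) = 0 , s≤s z≤n , x≡y
  nth-index (y ∷ xs) d (there x∈) with nth-index xs d x∈
  ... | t , t< , x≡ = suc t , s≤s t< , x≡

module Isomorphism (n k : ℕ) (1≤k : 1 ≤ k) (k+3≤n : k + 3 ≤ n) (G : Graph n)
                   (conn : Connected (adj G)) (cuts : HasExactlyCutEdges (adj G) k)
                   (Π≡bound : LowerBound.Π n k 1≤k k+3≤n G conn cuts
                                    ≡ LowerBound.bound n k 1≤k k+3≤n G conn cuts) where

  open Extremal n k 1≤k k+3≤n G conn cuts Π≡bound
  open CycleWalk

  m≥3 : 3 ≤ m
  m≥3 = k+3≤n⇒3≤n∸k k+3≤n

  0<m : 0 < m
  0<m = ≤-trans (s≤s z≤n) m≥3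

  m≤n : m ≤ n
  m≤n = m∸n≤m n k

  pendentAt : ℕ → Fin n
  pendentAt t = nth pendents t c

  index< : ∀ {a} → a < n → m ≤ a → a ∸ m < length pendents
  index< {a} a<n m≤a = subst (a ∸ m <_) (trans (m∸[m∸n]≡n k≤n) (sym p≡k)) (∸-monoˡ-< a<n m≤a)

  pendentAt-pendent : ∀ {a} → a < n → m ≤ a → deg (pendentAt (a ∸ m)) ≡ 1
  pendentAt-pendent a<n m≤a = pendents⁻ (nth-∈ pendents _ c (index< a<n m≤a))

  -- The vertex of G playing the role of index a of Cₙˢ: the cycle below m, the pendents above.
  vertexAt : ℕ → Fin n
  vertexAt a with a <? m
  ... | yes _ = vertex a
  ... | no  _ = pendentAt (a ∸ m)

  vertexAt-cycle : ∀ {a} → a < m → vertexAt a ≡ vertex a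
  vertexAt-cycle {a} a<m with a <? m
  ... | yes _   = refl
  ... | no  a≮m = ⊥-elim (a≮m a<m)

  vertexAt-pendent : ∀ {a} → m ≤ a → vertexAt a ≡ pendentAt (a ∸ m)
  vertexAt-pendent {a} m≤a with a <? m
  ... | yes a<m = ⊥-elim (<⇒≱ a<m m≤a)
  ... | no  _   = refl

  vertexAt-injective : ∀ {a b} → a < n → b < n → vertexAt a ≡ vertexAt b → a ≡ b
  vertexAt-injective {a} {b} a<n b<n eq with m ≤? a | m ≤? b
  ... | no m≰a | no m≰b = vertex-injective (≰⇒> m≰a) (≰⇒> m≰b)
        (trans (sym (vertexAt-cycle (≰⇒> m≰a))) (trans eq (vertexAt-cycle (≰⇒> m≰b))))
  ... | no m≰a | yes m≤b = ⊥-elim (not-pendent a (trans (cong deg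
        (trans (sym (vertexAt-cycle (≰⇒> m≰a))) (trans eq (vertexAt-pendent m≤b)))) (pendentAt-pendent b<n m≤b)))
  ... | yes m≤a | no m≰b = ⊥-elim (not-pendent b (trans (cong deg
        (trans (sym (vertexAt-cycle (≰⇒> m≰b))) (trans (sym eq) (vertexAt-pendent m≤a)))) (pendentAt-pendent a<n m≤a)))
  ... | yes m≤a | yes m≤b = ∸-cancelʳ-≡ m≤a m≤b (nth-injective pendents c pendents-unique
        (index< a<n m≤a) (index< b<n m≤b) (trans (sym (vertexAt-pendent m≤a)) (trans eq (vertexAt-pendent m≤b))))

  indexOf : Fin n → Fin n
  indexOf x with pendent? x
  ... | no  dx = fromℕ< (≤-trans (proj₁ (proj₂ (vertex-surjective x dx))) m≤n)
  ... | yes dx = fromℕ< {m + proj₁ (nth-index pendents c (pendents⁺ dx))}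
    (subst (m + proj₁ (nth-index pendents c (pendents⁺ dx)) <_) (trans (cong (m +_) p≡k) (m∸n+n≡m k≤n))
      (+-monoʳ-< m (proj₁ (proj₂ (nth-index pendents c (pendents⁺ dx))))))

  toVertex : Fin n → Fin n
  toVertex a = vertexAt (toℕ a)

  toVertex-indexOf : ∀ x → toVertex (indexOf x) ≡ x
  toVertex-indexOf x with pendent? x
  ... | no  dx = trans (cong vertexAt (FinP.toℕ-fromℕ< _))
    (trans (vertexAt-cycle (proj₁ (proj₂ (vertex-surjective x dx)))) (sym (proj₂ (proj₂ (vertex-surjective x dx)))))
  ... | yes dx = trans (cong vertexAt (FinP.toℕ-fromℕ< _)) (trans (vertexAt-pendent (m≤m+n m _))
    (trans (cong pendentAt (m+n∸m≡n m _)) (sym (proj₂ (proj₂ (nth-index pendents c (pendents⁺ dx)))))))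

  indexOf-toVertex : ∀ a → indexOf (toVertex a) ≡ a
  indexOf-toVertex a = FinP.toℕ-injective
    (vertexAt-injective (FinP.toℕ<n (indexOf (toVertex a))) (FinP.toℕ<n a) (toVertex-indexOf (toVertex a)))

  c-adjacent-previous-0 : A c (previous 0) ≡ true
  c-adjacent-previous-0 = proj₁ (cycleNeighbours⁻ (proj₂ (invariant 0)))

  c-adjacent-pendentAt : ∀ {b} → b < n → m ≤ b → A c (pendentAt (b ∸ m)) ≡ true
  c-adjacent-pendentAt b<n m≤b = trans (Graph.sym G _ _)
    (subst (λ z → A (pendentAt _) z ≡ true) (anchor≡c _ (pendentAt-pendent b<n m≤b))
      (anchor-adjacent (pendentAt-pendent b<n m≤b)))

  m-1<m : m ∸ 1 < m
  m-1<m = ∸-monoʳ-< {m} {1} {0} (s≤s z≤n) 0<m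

  CSEdge⇒adjacent : ∀ a b → a < n → b < n → CSEdge m a b → A (vertexAt a) (vertexAt b) ≡ true
  CSEdge⇒adjacent a b _ _ (inj₁ (a<m , b<m , cyc)) rewrite vertexAt-cycle a<m | vertexAt-cycle b<m = cycle cyc
    where
    cycle : CycleEdge m a b → A (vertex a) (vertex b) ≡ true
    cycle (inj₁ refl)                      = walk-adjacent a
    cycle (inj₂ (inj₁ refl))               = trans (Graph.sym G _ _) (walk-adjacent b)
    cycle (inj₂ (inj₂ (inj₁ (refl , refl)))) = subst (λ z → A c z ≡ true) previous-0 c-adjacent-previous-0
    cycle (inj₂ (inj₂ (inj₂ (refl , refl)))) =
      trans (Graph.sym G _ _) (subst (λ z → A c z ≡ true) previous-0 c-adjacent-previous-0)
  CSEdge⇒adjacent .0 b _ b<n (inj₂ (inj₁ (refl , m≤b))) rewrite vertexAt-cycle 0<m | vertexAt-pendent m≤b =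
    c-adjacent-pendentAt b<n m≤b
  CSEdge⇒adjacent a .0 a<n _ (inj₂ (inj₂ (refl , m≤a))) rewrite vertexAt-cycle 0<m | vertexAt-pendent m≤a =
    trans (Graph.sym G _ _) (c-adjacent-pendentAt a<n m≤a)

  adjacent⇒CSEdge : ∀ a b → a < n → b < n → A (vertexAt a) (vertexAt b) ≡ true → CSEdge m a b
  adjacent⇒CSEdge a b a<n b<n ab with m ≤? a | m ≤? b
  ... | no m≰a | no m≰b = inj₁ (a<m , b<m , cycle)
    where
    a<m : a < m
    a<m = ≰⇒> m≰a
    b<m : b < m
    b<m = ≰⇒> m≰b
    ab′ : A (vertex a) (vertex b) ≡ true
    ab′ = trans (cong₂ A (sym (vertexAt-cycle a<m)) (sym (vertexAt-cycle b<m))) ab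
    backwards : ∀ x → x < m → vertex b ≡ previous x → CycleEdge m x b
    backwards zero     _   b≡ = inj₂ (inj₂ (inj₁ (refl , vertex-injective b<m m-1<m (trans b≡ previous-0))))
    backwards (suc a′) x<m b≡ = inj₂ (inj₁ (cong suc (sym (vertex-injective b<m (≤-trans (n≤1+n _) x<m) b≡))))
    cycle : CycleEdge m a b
    cycle with two-neighbours a (cycleNeighbours⁺ ab′ (not-pendent b))
    ... | inj₁ b≡prev = backwards a a<m b≡prev
    ... | inj₂ b≡next with m≤n⇒m<n∨m≡n a<m
    ...   | inj₁ 1+a<m = inj₁ (vertex-injective b<m 1+a<m b≡next)
    ...   | inj₂ 1+a≡m = inj₂ (inj₂ (inj₂ (vertex-injective b<m 0<m (trans b≡next (trans (cong vertex 1+a≡m) vertex-m)) ,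
                           cong (_∸ 1) 1+a≡m)))
  ... | no m≰a | yes m≤b = inj₂ (inj₁ (vertex-injective (≰⇒> m≰a) 0<m
        (pendent-neighbour≡c (pendentAt-pendent b<n m≤b)
          (trans (Graph.sym G _ _) (trans (cong₂ A (sym (vertexAt-cycle (≰⇒> m≰a))) (sym (vertexAt-pendent m≤b))) ab))) , m≤b))
  ... | yes m≤a | no m≰b = inj₂ (inj₂ (vertex-injective (≰⇒> m≰b) 0<m
        (pendent-neighbour≡c (pendentAt-pendent a<n m≤a)
          (trans (cong₂ A (sym (vertexAt-pendent m≤a)) (sym (vertexAt-cycle (≰⇒> m≰b)))) ab)) , m≤a))
  ... | yes m≤a | yes m≤b = ⊥-elim (no-adjacent-pendents (pendentAt-pendent a<n m≤a) (pendentAt-pendent b<n m≤b)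
        (trans (cong₂ A (sym (vertexAt-pendent m≤a)) (sym (vertexAt-pendent m≤b))) ab))

  adjacency-agrees : ∀ a b → a < n → b < n → A (vertexAt a) (vertexAt b) ≡ csAdjℕ n k a b
  adjacency-agrees a b a<n b<n = Bool.⇔→≡ {z = true} (mk⇔
    (λ ab → csAdjℕ-complete n k a b (adjacent⇒CSEdge a b a<n b<n ab))
    (λ ab → CSEdge⇒adjacent a b a<n b<n (csAdjℕ-sound n k a b ab)))

  isomorphic : adj G ≅ C^S n k
  isomorphic = mk↔ₛ′ indexOf toVertex indexOf-toVertex toVertex-indexOf , λ u v →
    trans (cong₂ A (sym (toVertex-indexOf u)) (sym (toVertex-indexOf v)))
      (adjacency-agrees (toℕ (indexOf u)) (toℕ (indexOf v)) (FinP.toℕ<n (indexOf u)) (FinP.toℕ<n (indexOf v)))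

-- The product of degrees: invariance under isomorphism, and its value for Cₙˢ.

-- Isomorphic graphs have the same degrees up to the relabelling, hence the same
-- product of degrees.
module _ {n : ℕ} {A B : Adj n} (iso : A ≅ B) where

  private
    σ : Fin n ↔ Fin n
    σ = proj₁ iso

    to : Fin n → Fin n
    to = Inverse.to σ

    to-injective : ∀ {x y} → to x ≡ to y → x ≡ y
    to-injective {x} {y} eq = trans (sym (Inverse.strictlyInverseʳ σ x))
      (trans (cong (Inverse.from σ) eq) (Inverse.strictlyInverseʳ σ y))

    to-permutes : map to (allFin n) ↭ allFin n
    to-permutes = unique-same-members-↭
      (unique-map to (Unique.allFin⁺ n) λ _ _ → to-injective) (Unique.allFin⁺ n)
      (λ {z} _ → ∈-allFin z)
      (λ {z} _ → subst (_∈ map to (allFin n)) (Inverse.strictlyInverseˡ σ z) (∈-map⁺ to (∈-allFin _)))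

    relabel : ∀ (f : Fin n → ℕ) → map (λ u → f (to u)) (allFin n) ↭ map f (allFin n)
    relabel f = subst (_↭ map f (allFin n)) (sym (map-∘ (allFin n))) (Perm.map⁺ f to-permutes)

  degree-invariant : ∀ u → degree A u ≡ degree B (to u)
  degree-invariant u =
    trans (cong sum (map-cong (λ v → cong (λ b → if b then 1 else 0) (proj₂ iso u v)) (allFin n)))
    (sum-↭ (relabel (λ w → if B (to u) w then 1 else 0)))

  productOfDegrees-invariant : productOfDegrees A ≡ productOfDegrees B
  productOfDegrees-invariant = trans (cong product (map-cong degree-invariant (allFin n)))
    (product-↭ (relabel (degree B)))

map-allFin-toℕ : ∀ {X : Set} n (g : ℕ → X) → map (λ i → g (toℕ i)) (allFin n) ≡ applyUpTo g n
map-allFin-toℕ n g = trans (map-tabulate (λ i → i) (λ i → g (toℕ i))) (tabulate-toℕ n g)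
  where
  tabulate-toℕ : ∀ {X : Set} n (g : ℕ → X) → tabulate {n = n} (λ i → g (toℕ i)) ≡ applyUpTo g n
  tabulate-toℕ zero    g = refl
  tabulate-toℕ (suc n) g = cong (g 0 ∷_) (tabulate-toℕ n (λ x → g (suc x)))

module CₙˢProduct (n k : ℕ) (k+3≤n : k + 3 ≤ n) where

  m : ℕ
  m = n ∸ k

  m≥3 : 3 ≤ m
  m≥3 = k+3≤n⇒3≤n∸k k+3≤n

  0<m : 0 < m
  0<m = ≤-trans (s≤s z≤n) m≥3

  m+k≡n : m + k ≡ n
  m+k≡n = m∸n+n≡m (≤-trans (m≤m+n k 3) k+3≤n)

  m≤n : m ≤ n
  m≤n = m∸n≤m n k

  m-1<m : m ∸ 1 < m
  m-1<m = ∸-monoʳ-< {m} {1} {0} (s≤s z≤n) 0<m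

  csDegree : ℕ → ℕ
  csDegree zero    = k + 2
  csDegree (suc a) = if suc a <ᵇ m then 2 else 1

  csNeighbours : ℕ → List ℕ
  csNeighbours a = filter (λ b → csAdjℕ n k a b Bool.≟ true) (upTo n)

  csNeighbours⁺ : ∀ {a b} → b < n → CSEdge m a b → b ∈ csNeighbours a
  csNeighbours⁺ {a} {b} b<n ab =
    ∈-filter⁺ (λ b → csAdjℕ n k a b Bool.≟ true) (∈-upTo⁺ b<n) (csAdjℕ-complete n k a b ab)

  csNeighbours⁻ : ∀ {a b} → b ∈ csNeighbours a → b < n × CSEdge m a b
  csNeighbours⁻ {a} {b} b∈ with ∈-filter⁻ (λ b → csAdjℕ n k a b Bool.≟ true) {xs = upTo n} b∈
  ... | b∈upTo , ab = ∈-upTo⁻ b∈upTo , csAdjℕ-sound n k a b ab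

  count-neighbours : ∀ {a} (E : List ℕ) → Unique E → (∀ {b} → b ∈ E → b < n × CSEdge m a b) →
    (∀ {b} → b < n → CSEdge m a b → b ∈ E) → length (csNeighbours a) ≡ length E
  count-neighbours {a} E E-unique E-edges E-complete = unique-same-members-length
    (Unique.filter⁺ _ (Unique.upTo⁺ n)) E-unique
    (λ b∈ → E-complete (proj₁ (csNeighbours⁻ b∈)) (proj₂ (csNeighbours⁻ b∈)))
    (λ b∈ → csNeighbours⁺ (proj₁ (E-edges b∈)) (proj₂ (E-edges b∈)))

  degree-centre : length (csNeighbours 0) ≡ k + 2
  degree-centre = trans (count-neighbours (1 ∷ (m ∸ 1) ∷ pendentIndices) E-unique E-edges E-complete)
    (trans (cong (λ l → suc (suc l)) (length-applyUpTo (m +_) k)) (+-comm 2 k))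
    where
    pendentIndices : List ℕ
    pendentIndices = applyUpTo (m +_) k
    pendentIndex≥m : ∀ {b} → b ∈ pendentIndices → m ≤ b
    pendentIndex≥m b∈ with ∈-applyUpTo⁻ (m +_) b∈
    ... | i , _ , refl = m≤m+n m i
    2≤m-1 : 2 ≤ m ∸ 1
    2≤m-1 = ∸-monoˡ-≤ 1 m≥3
    E-unique : Unique (1 ∷ (m ∸ 1) ∷ pendentIndices)
    E-unique = unique-cons (unique-cons
      (Unique.applyUpTo⁺₁ (m +_) k λ i<j _ eq → <⇒≢ i<j (+-cancelˡ-≡ m _ _ eq))
      (λ m-1∈ → <⇒≱ m-1<m (pendentIndex≥m m-1∈)))
      λ { (here 1≡m-1) → <-irrefl 1≡m-1 2≤m-1 ; (there 1∈) → <⇒≱ (≤-trans (s≤s (s≤s z≤n)) m≥3) (pendentIndex≥m 1∈) }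
    E-edges : ∀ {b} → b ∈ 1 ∷ (m ∸ 1) ∷ pendentIndices → b < n × CSEdge m 0 b
    E-edges (here refl) = ≤-trans (s≤s (s≤s z≤n)) (≤-trans m≥3 m≤n) ,
      inj₁ (0<m , ≤-trans (s≤s (s≤s z≤n)) m≥3 , inj₁ refl)
    E-edges (there (here refl)) = <-≤-trans m-1<m m≤n , inj₁ (0<m , m-1<m , inj₂ (inj₂ (inj₁ (refl , refl))))
    E-edges (there (there b∈)) with ∈-applyUpTo⁻ (m +_) b∈
    ... | i , i<k , refl = subst (m + i <_) m+k≡n (+-monoʳ-< m i<k) , inj₂ (inj₁ (refl , m≤m+n m i))
    E-complete : ∀ {b} → b < n → CSEdge m 0 b → b ∈ 1 ∷ (m ∸ 1) ∷ pendentIndices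
    E-complete _ (inj₁ (_ , _ , inj₁ refl))                      = here refl
    E-complete _ (inj₁ (_ , _ , inj₂ (inj₂ (inj₁ (_ , refl)))))  = there (here refl)
    E-complete _ (inj₁ (_ , _ , inj₂ (inj₂ (inj₂ (_ , 0≡m-1))))) = ⊥-elim (<-irrefl 0≡m-1 (≤-trans (s≤s z≤n) 2≤m-1))
    E-complete {b} b<n (inj₂ (inj₁ (_ , m≤b))) = there (there (subst (_∈ pendentIndices) (m+[n∸m]≡n m≤b)
      (∈-applyUpTo⁺ (m +_) (subst (b ∸ m <_) (trans (cong (_∸ m) (sym m+k≡n)) (m+n∸m≡n m k)) (∸-monoˡ-< b<n m≤b)))))
    E-complete _ (inj₂ (inj₂ (_ , m≤0))) = ⊥-elim (<⇒≱ 0<m m≤0)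

  degree-cycle : ∀ a → suc a < m → length (csNeighbours (suc a)) ≡ 2
  degree-cycle a 1+a<m with suc (suc a) <? m
  ... | yes 2+a<m = count-neighbours (suc (suc a) ∷ a ∷ [])
        (unique-cons (unique-cons [] λ ()) λ { (here 2+a≡a) → <-irrefl (sym 2+a≡a) (n≤1+n (suc a)) })
        (λ { (here refl) → <-≤-trans 2+a<m m≤n , inj₁ (1+a<m , 2+a<m , inj₁ refl)
           ; (there (here refl)) → <-≤-trans a<m m≤n , inj₁ (1+a<m , a<m , inj₂ (inj₁ refl)) })
        λ { _ (inj₁ (_ , _ , inj₁ refl)) → here refl
          ; _ (inj₁ (_ , _ , inj₂ (inj₁ refl))) → there (here refl)
          ; _ (inj₁ (_ , _ , inj₂ (inj₂ (inj₂ (_ , 1+a≡m-1))))) → ⊥-elim (<-irrefl refl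
              (subst (suc (suc a) <_) (trans (sym (m+[n∸m]≡n 0<m)) (cong suc (sym 1+a≡m-1))) 2+a<m))
          ; _ (inj₂ (inj₂ (_ , m≤1+a))) → ⊥-elim (<⇒≱ 1+a<m m≤1+a) }
    where
    a<m : a < m
    a<m = ≤-trans (n≤1+n _) 1+a<m
  ... | no 2+a≮m = count-neighbours (0 ∷ a ∷ [])
        (unique-cons (unique-cons [] λ ()) λ { (here 0≡a) → <-irrefl (trans 0≡a a≡m-2) (∸-monoˡ-≤ 2 m≥3) })
        (λ { (here refl) → <-≤-trans 0<m m≤n , inj₁ (1+a<m , 0<m , inj₂ (inj₂ (inj₂ (refl , 1+a≡m-1))))
           ; (there (here refl)) → <-≤-trans a<m m≤n , inj₁ (1+a<m , a<m , inj₂ (inj₁ refl)) })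
        λ { _ (inj₁ (_ , 2+a<m , inj₁ refl)) → ⊥-elim (2+a≮m 2+a<m)
          ; _ (inj₁ (_ , _ , inj₂ (inj₁ refl))) → there (here refl)
          ; _ (inj₁ (_ , _ , inj₂ (inj₂ (inj₂ (refl , _))))) → here refl
          ; _ (inj₂ (inj₂ (_ , m≤1+a))) → ⊥-elim (<⇒≱ 1+a<m m≤1+a) }
    where
    a<m : a < m
    a<m = ≤-trans (n≤1+n _) 1+a<m
    2+a≡m : suc (suc a) ≡ m
    2+a≡m = ≤-antisym 1+a<m (≮⇒≥ 2+a≮m)
    1+a≡m-1 : suc a ≡ m ∸ 1
    1+a≡m-1 = cong (_∸ 1) 2+a≡m
    a≡m-2 : a ≡ m ∸ 2
    a≡m-2 = cong (_∸ 2) 2+a≡m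

  degree-pendent : ∀ a → m ≤ suc a → length (csNeighbours (suc a)) ≡ 1
  degree-pendent a m≤1+a = count-neighbours (0 ∷ []) ([] ∷ [])
    (λ { (here refl) → ≤-trans 0<m m≤n , inj₂ (inj₂ (refl , m≤1+a)) })
    λ { _ (inj₁ (1+a<m , _)) → ⊥-elim (<⇒≱ 1+a<m m≤1+a)
      ; _ (inj₂ (inj₂ (refl , _))) → here refl }

  degree-C^S : ∀ (w : Fin n) → degree (C^S n k) w ≡ csDegree (toℕ w)
  degree-C^S w = begin
    degree (C^S n k) w                              ≡⟨ cong sum (map-allFin-toℕ n indicator) ⟩
    sum (applyUpTo indicator n)                     ≡⟨ cong sum (sym (map-upTo indicator n)) ⟩
    sum (map indicator (upTo n))                    ≡⟨ count-true (csAdjℕ n k (toℕ w)) (upTo n) ⟩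
    length (csNeighbours (toℕ w))                   ≡⟨ by-index (toℕ w) ⟩
    csDegree (toℕ w)                                ∎
    where
    open ≡-Reasoning
    indicator : ℕ → ℕ
    indicator b = if csAdjℕ n k (toℕ w) b then 1 else 0
    by-index : ∀ a → length (csNeighbours a) ≡ csDegree a
    by-index zero    = degree-centre
    by-index (suc a) with suc a <? m
    ... | yes 1+a<m = trans (degree-cycle a 1+a<m)
                        (cong (λ b → if b then 2 else 1) (sym (T⇒≡true (<⇒<ᵇ 1+a<m))))
    ... | no  1+a≮m = trans (degree-pendent a (≮⇒≥ 1+a≮m))
                        (cong (λ b → if b then 2 else 1) (sym (<ᵇ-false⁺ (≮⇒≥ 1+a≮m))))

  private
    prefixProduct : ℕ → ℕ
    prefixProduct N = product (applyUpTo csDegree N)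

    prefixProduct-suc : ∀ N → prefixProduct (suc N) ≡ prefixProduct N * csDegree N
    prefixProduct-suc N = trans (cong product (sym (applyUpTo-∷ʳ csDegree N)))
      (trans (product-++ (applyUpTo csDegree N) (csDegree N ∷ [])) (cong (prefixProduct N *_) (*-identityʳ _)))

    prefixProduct-cycle : ∀ t → suc t ≤ m → prefixProduct (suc t) ≡ (k + 2) * 2 ^ t
    prefixProduct-cycle zero    _       = refl
    prefixProduct-cycle (suc t) 2+t≤m = begin
      prefixProduct (suc (suc t))             ≡⟨ prefixProduct-suc (suc t) ⟩
      prefixProduct (suc t) * csDegree (suc t) ≡⟨ cong₂ _*_ (prefixProduct-cycle t (≤-trans (n≤1+n _) 2+t≤m))
                                                       (cong (λ b → if b then 2 else 1) (T⇒≡true (<⇒<ᵇ 2+t≤m))) ⟩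
      (k + 2) * 2 ^ t * 2                     ≡⟨ *-assoc (k + 2) (2 ^ t) 2 ⟩
      (k + 2) * (2 ^ t * 2)                   ≡⟨ cong ((k + 2) *_) (*-comm (2 ^ t) 2) ⟩
      (k + 2) * 2 ^ suc t                     ∎
      where open ≡-Reasoning

    prefixProduct-pendents : ∀ s → prefixProduct (m + s) ≡ (k + 2) * 2 ^ (m ∸ 1)
    prefixProduct-pendents zero = trans (cong prefixProduct (trans (+-identityʳ m) (sym (m+[n∸m]≡n 0<m))))
      (prefixProduct-cycle (m ∸ 1) (≤-reflexive (m+[n∸m]≡n 0<m)))
    prefixProduct-pendents (suc s) = begin
      prefixProduct (m + suc s)               ≡⟨ cong prefixProduct (+-suc m s) ⟩
      prefixProduct (suc (m + s))             ≡⟨ prefixProduct-suc (m + s) ⟩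
      prefixProduct (m + s) * csDegree (m + s) ≡⟨ cong₂ _*_ (prefixProduct-pendents s)
                                                       (pendent-factor (m + s) (m≤m+n m s)) ⟩
      (k + 2) * 2 ^ (m ∸ 1) * 1               ≡⟨ *-identityʳ _ ⟩
      (k + 2) * 2 ^ (m ∸ 1)                   ∎
      where
      open ≡-Reasoning
      pendent-factor : ∀ a → m ≤ a → csDegree a ≡ 1
      pendent-factor zero    m≤0   = ⊥-elim (<⇒≱ 0<m m≤0)
      pendent-factor (suc a) m≤1+a = cong (λ b → if b then 2 else 1) (<ᵇ-false⁺ m≤1+a)

  productOfDegrees-C^S : productOfDegrees (C^S n k) ≡ 2 ^ (n ∸ k ∸ 1) * (k + 2)
  productOfDegrees-C^S = begin
    product (map (degree (C^S n k)) (allFin n))             ≡⟨ cong product (map-cong degree-C^S (allFin n)) ⟩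
    product (map (λ w → csDegree (toℕ w)) (allFin n))      ≡⟨ cong product (map-allFin-toℕ n csDegree) ⟩
    prefixProduct n                                         ≡⟨ cong prefixProduct (sym m+k≡n) ⟩
    prefixProduct (m + k)                                   ≡⟨ prefixProduct-pendents k ⟩
    (k + 2) * 2 ^ (m ∸ 1)                                   ≡⟨ *-comm (k + 2) _ ⟩
    2 ^ (n ∸ k ∸ 1) * (k + 2)                               ∎
    where open ≡-Reasoning

theorem3p1 : (n k : ℕ) → 1 ≤ k → k + 3 ≤ n →
    (G : Graph n) → Connected (adj G) → HasExactlyCutEdges (adj G) k →
    (4 ^ (n ∸ k ∸ 1) * (k + 2) ^ 2 ≤ Π₁ G)
    × ((Π₁ G ≡ 4 ^ (n ∸ k ∸ 1) * (k + 2) ^ 2) ⇔ (adj G ≅ C^S n k))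
theorem3p1 n k 1≤k k+3≤n G conn cuts =
    subst₂ _≤_ (sym bound²) (sym Π₁²) (^-monoˡ-≤ 2 bound≤Π)
  , mk⇔ (λ Π₁≡ → Isomorphism.isomorphic n k 1≤k k+3≤n G conn cuts
                    (square-injective (trans (sym Π₁²) (trans Π₁≡ bound²))))
        (λ G≅Cₙˢ → trans Π₁² (trans (cong (_^ 2) (trans (productOfDegrees-invariant G≅Cₙˢ)
                     (CₙˢProduct.productOfDegrees-C^S n k k+3≤n))) (sym bound²)))
  where
  open LowerBound n k 1≤k k+3≤n G conn cuts using (Π; bound; bound≤Π)
  Π₁² : Π₁ G ≡ Π ^ 2
  Π₁² = Π₁≡square G
  bound² : 4 ^ (n ∸ k ∸ 1) * (k + 2) ^ 2 ≡ bound ^ 2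
  bound² = bound-as-square (n ∸ k ∸ 1) (k + 2)
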